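{- For any positive integers $d$ and $n$ and any integer $s\ge 3d+2$, $$N_{d,ns-1}(s)=N_{d,n(s-1)-1}(s-1)+(n+1)\,N_{d,n(s-d-1)-1}(s-d-1).$$
   Context: A partition $\lambda=(\lambda_1,\dots,\lambda_k)$ is a finite nonincreasing sequence of positive integers (the empty partition is allowed). In its Young diagram (row $i$ has $\lambda_i$ left-justified cells), the hook length $h(i,j)$ of cell $(i,j)$ is $1$ plus the number of cells to its right in its row plus the number of cells below it in its column. For a positive integer $t$, $\lambda$ is $t$-core if no cell has hook length $t$; it is $(s,s+r)$-core if it is both $s$-core and $(s+r)$-core. $\lambda$ has $d$-distinct parts if $\lambda_i-\lambda_{i+1}\ge d$ for all $1\le i\le k-1$. For positive integers $d,r,s$, $N_{d,r}(s)$ is the number of $(s,s+r)$-core partitions with $d$-distinct parts. -}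

module Defs where

open import Data.Nat using (ℕ; zero; suc; _+_; _*_; _∸_; _≤_; _<_; _<?_)
open import Data.Fin using (Fin; toℕ)
open import Data.List using (List; length; lookup; drop; filter)
open import Data.List.Relation.Unary.All using (All)
open import Data.List.Relation.Unary.Linked using (Linked)
open import Data.List.Relation.Unary.Unique.Propositional using (Unique)
open import Data.List.Membership.Propositional using (_∈_)
open import Data.Product using (Σ; _×_)
open import Function.Bundles using (_⇔_)
open import Relation.Nullary using (¬_)
open import Relation.Binary.PropositionalEquality using (_≡_)

IsPartition : List ℕ → Set
IsPartition λs = All (λ p → 1 ≤ p) λs × Linked (λ a b → b ≤ a) λs

-- Cells: (i , j) with i : Fin (length λ) (row, 0-indexed) and j < λ_i (column, 0-indexed).
-- arm = number of cells to the right of (i , j) in row i.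
arm : (λs : List ℕ) → Fin (length λs) → ℕ → ℕ
arm λs i j = lookup λs i ∸ suc j

leg : (λs : List ℕ) → Fin (length λs) → ℕ → ℕ
leg λs i j = length (filter (j <?_) (drop (suc (toℕ i)) λs))

hook : (λs : List ℕ) → Fin (length λs) → ℕ → ℕ
hook λs i j = suc (arm λs i j + leg λs i j)

IsCore : ℕ → List ℕ → Set
IsCore t λs = (i : Fin (length λs)) (j : ℕ) → j < lookup λs i → ¬ (hook λs i j ≡ t)

DDistinct : ℕ → List ℕ → Set
DDistinct d λs = Linked (λ a b → d + b ≤ a) λs

-- The property counted by N_{d,r}(s): an (s, s+r)-core partition with d-distinct parts.
CoreDDistinct : ℕ → ℕ → ℕ → List ℕ → Set
CoreDDistinct d r s λs =
  IsPartition λs × IsCore s λs × IsCore (s + r) λs × DDistinct d λs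

HasCount : {A : Set} → (A → Set) → ℕ → Set
HasCount {A} P k =
  Σ (List A) (λ xs → Unique xs × ((x : A) → (x ∈ xs ⇔ P x)) × length xs ≡ k)

N≡ : ℕ → ℕ → ℕ → ℕ → Set
N≡ d r s k = HasCount (CoreDDistinct d r s) k

-- Through β-numbers (first-column hook lengths), an (s, s + ns − 1)-core with d-distinct parts is a finite set H
-- of positive integers whose elements differ by more than d and which is closed under x ↦ x − s; closure under
-- x ↦ x − (s + ns − 1) then amounts to all elements lying below s + ns − 1, because d ≥ 1. Laid out on an abacus
-- with s runners, H becomes the word of bead counts of the runners, subject to local conditions. Let ℓ be the last
-- occupied runner among 1, …, d and p = ℓ + d + 1. If runner p is empty, removing it leaves an abacus with s − 1
-- runners; otherwise it carries i + 1 ≤ n + 1 beads, runners p + 1, …, p + d are empty, and removing these d + 1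
-- runners leaves an abacus with s − d − 1 runners. The runners before p are untouched, so p is recovered and the
-- removal can be undone (s − d − 1 ≥ 2d + 1 keeps p inside the smaller abacus); this bijection is the recurrence.

module Submission where

open import Defs
open import Data.Nat using (ℕ; zero; suc; _+_; _*_; _∸_; _≤_; _<_; _≤?_; _<?_; _≟_; z≤n; s≤s; NonZero)
open import Data.Nat.Properties
open import Data.Nat.DivMod using (_%_; _/_; m≡m%n+[m/n]*n; m%n<n; [m+kn]%n≡m%n; m<n⇒m%n≡m)
open import Data.Nat.Tactic.RingSolver using (solve-∀)
open import Data.Fin using () renaming (zero to fzero; suc to fsuc)
open import Data.List using (List; []; _∷_; length; map; filter; _++_; take; drop; replicate; upTo; downFrom; applyUpTo; cartesianProduct; cartesianProductWith)
open import Data.List.Properties using (length-map; length-++; length-upTo; length-applyUpTo; length-take; length-drop; length-replicate; filter-accept; filter-reject; ∷-injective)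
open import Data.List.Relation.Unary.All as All using (All; []; _∷_)
open import Data.List.Relation.Unary.All.Properties using () renaming (map⁺ to All-map⁺)
open import Data.List.Relation.Unary.Any using (here; there)
open import Data.List.Relation.Unary.AllPairs using (AllPairs; []; _∷_)
open import Data.List.Relation.Unary.Linked as Linked using (Linked; []; [-]; _∷_)
open import Data.List.Relation.Unary.Linked.Properties using (Linked⇒All; Linked⇒AllPairs) renaming (filter⁺ to Linked-filter⁺; applyDownFrom⁺₂ to Linked-applyDownFrom⁺₂)
open import Data.List.Relation.Unary.Unique.Propositional using (Unique)
import Data.List.Relation.Unary.Unique.Propositional.Properties as Unique
open import Data.List.Membership.Propositional using (_∈_; _∉_)
open import Data.List.Membership.Propositional.Properties
open import Data.List.Membership.DecPropositional _≟_ using (_∈?_)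
open import Data.Product using (Σ; _×_; _,_; proj₁; proj₂)
open import Data.Sum using (_⊎_; inj₁; inj₂; [_,_]′)
import Data.Sum as Sum
open import Data.Sum.Properties using (inj₁-injective; inj₂-injective)
open import Data.Empty using (⊥; ⊥-elim)
open import Function using (id; _∘_)
open import Function.Bundles using (_⇔_; mk⇔; Equivalence)
open import Relation.Nullary using (¬_; Dec; yes; no)
open import Relation.Nullary.Decidable using (map′; _×-dec_; _⊎-dec_; _→-dec_)
open import Relation.Unary using (_⟨×⟩_; _⟨⊎⟩_)
open import Relation.Binary.PropositionalEquality
open import Relation.Binary.Definitions using (tri<; tri≈; tri>)

-- Counting

Unique-map⁺ : {A B : Set} (f : A → B) {xs : List A} →
  (∀ {x y} → x ∈ xs → y ∈ xs → f x ≡ f y → x ≡ y) → Unique xs → Unique (map f xs)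
Unique-map⁺ f {[]} _ [] = []
Unique-map⁺ f {x ∷ xs} inj (x∉xs ∷ u) =
  All-map⁺ (All.tabulate λ y∈xs fx≡fy → All.lookup x∉xs y∈xs (inj (here refl) (there y∈xs) fx≡fy))
  ∷ Unique-map⁺ f (λ x∈xs y∈xs → inj (there x∈xs) (there y∈xs)) u

HasCount-bijection : {A B : Set} {P : A → Set} {Q : B → Set} {k : ℕ} (f : A → B) (g : B → A) →
  (∀ a → P a → Q (f a)) → (∀ b → Q b → P (g b)) →
  (∀ a → P a → g (f a) ≡ a) → (∀ b → Q b → f (g b) ≡ b) →
  HasCount P k → HasCount Q k
HasCount-bijection {P = P} {Q} f g pq qp gf fg (xs , u , mem , len) =
  map f xs , Unique-map⁺ f inj u , (λ b → mk⇔ (to b) (from b)) , trans (length-map f xs) len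
  where
  P⇒ : ∀ {a} → a ∈ xs → P a
  P⇒ {a} = Equivalence.to (mem a)
  inj : ∀ {x y} → x ∈ xs → y ∈ xs → f x ≡ f y → x ≡ y
  inj {x} {y} x∈xs y∈xs fx≡fy =
    trans (sym (gf x (P⇒ x∈xs))) (trans (cong g fx≡fy) (gf y (P⇒ y∈xs)))
  to : ∀ b → b ∈ map f xs → Q b
  to b b∈ with a , a∈xs , refl ← ∈-map⁻ f b∈ = pq a (P⇒ a∈xs)
  from : ∀ b → Q b → b ∈ map f xs
  from b q = subst (_∈ map f xs) (fg b q) (∈-map⁺ f (Equivalence.from (mem (g b)) (qp b q)))

HasCount-⊎ : {A B : Set} {P : A → Set} {Q : B → Set} {k m : ℕ} →
  HasCount P k → HasCount Q m → HasCount (P ⟨⊎⟩ Q) (k + m)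
HasCount-⊎ {P = P} {Q} (xs , u , mem , len) (ys , v , mem′ , len′) =
  map inj₁ xs ++ map inj₂ ys ,
  Unique.++⁺ (Unique.map⁺ inj₁-injective u) (Unique.map⁺ inj₂-injective v) disjoint ,
  (λ z → mk⇔ (to z) (from z)) ,
  trans (length-++ (map inj₁ xs))
        (cong₂ _+_ (trans (length-map inj₁ xs) len) (trans (length-map inj₂ ys) len′))
  where
  disjoint : ∀ {z} → ¬ (z ∈ map inj₁ xs × z ∈ map inj₂ ys)
  disjoint (z∈₁ , z∈₂) with _ , _ , refl ← ∈-map⁻ inj₁ z∈₁ with _ , _ , () ← ∈-map⁻ inj₂ z∈₂
  to : ∀ z → z ∈ map inj₁ xs ++ map inj₂ ys → (P ⟨⊎⟩ Q) z
  to z z∈ with ∈-++⁻ (map inj₁ xs) z∈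
  ... | inj₁ z∈₁ with a , a∈ , refl ← ∈-map⁻ inj₁ z∈₁ = Equivalence.to (mem a) a∈
  ... | inj₂ z∈₂ with b , b∈ , refl ← ∈-map⁻ inj₂ z∈₂ = Equivalence.to (mem′ b) b∈
  from : ∀ z → (P ⟨⊎⟩ Q) z → z ∈ map inj₁ xs ++ map inj₂ ys
  from (inj₁ a) p = ∈-++⁺ˡ (∈-map⁺ inj₁ (Equivalence.from (mem a) p))
  from (inj₂ b) q = ∈-++⁺ʳ (map inj₁ xs) (∈-map⁺ inj₂ (Equivalence.from (mem′ b) q))

length-cartesianProduct : {A B : Set} (xs : List A) (ys : List B) →
  length (cartesianProduct xs ys) ≡ length xs * length ys
length-cartesianProduct [] ys = refl
length-cartesianProduct (x ∷ xs) ys =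
  trans (length-++ (map (x ,_) ys))
        (cong₂ _+_ (length-map (x ,_) ys) (length-cartesianProduct xs ys))

HasCount-× : {A B : Set} {P : A → Set} {Q : B → Set} {k m : ℕ} →
  HasCount P k → HasCount Q m → HasCount (P ⟨×⟩ Q) (k * m)
HasCount-× {P = P} {Q} (xs , u , mem , len) (ys , v , mem′ , len′) =
  cartesianProduct xs ys , Unique.cartesianProduct⁺ u v ,
  (λ { (a , b) → mk⇔ (to a b) (from a b) }) ,
  trans (length-cartesianProduct xs ys) (cong₂ _*_ len len′)
  where
  to : ∀ a b → (a , b) ∈ cartesianProduct xs ys → P a × Q b
  to a b ab∈ with a∈ , b∈ ← ∈-cartesianProduct⁻ xs ys ab∈ =
    Equivalence.to (mem a) a∈ , Equivalence.to (mem′ b) b∈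
  from : ∀ a b → P a × Q b → (a , b) ∈ cartesianProduct xs ys
  from a b (p , q) = ∈-cartesianProduct⁺ (Equivalence.from (mem a) p) (Equivalence.from (mem′ b) q)

HasCount-< : ∀ m → HasCount (_< m) m
HasCount-< m = upTo m , Unique.upTo⁺ m , (λ i → mk⇔ ∈-upTo⁻ ∈-upTo⁺) , length-upTo m

HasCount-filter : {A : Set} {P : A → Set} (P? : ∀ a → Dec (P a)) (xs : List A) → Unique xs →
  (∀ a → P a → a ∈ xs) → HasCount P (length (filter P? xs))
HasCount-filter P? xs u cover =
  filter P? xs , Unique.filter⁺ P? {xs} u ,
  (λ a → mk⇔ (λ a∈ → proj₂ (∈-filter⁻ P? {xs = xs} a∈)) (λ p → ∈-filter⁺ P? (cover a p) p)) , refl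

-- β-numbers and hook lengths

≤⇒offset : ∀ {m n} → m ≤ n → Σ ℕ λ k → n ≡ m + k
≤⇒offset {zero} {n} _ = n , refl
≤⇒offset {suc m} {suc n} (s≤s m≤n) with k , refl ← ≤⇒offset m≤n = k , refl

NonIncreasing : List ℕ → Set
NonIncreasing = Linked (λ a b → b ≤ a)

Decreasing : List ℕ → Set
Decreasing = Linked (λ a b → b < a)

Sparse : ℕ → List ℕ → Set
Sparse d = Linked (λ a b → d + b < a)

NonIncreasing-head≥ : ∀ {p rest} → NonIncreasing (p ∷ rest) → All (_≤ p) rest
NonIncreasing-head≥ [-] = []
NonIncreasing-head≥ (q≤p ∷ l) = Linked⇒All (λ b≤a c≤b → ≤-trans c≤b b≤a) q≤p l

Sparse⇒Decreasing : ∀ {d H} → Sparse d H → Decreasing H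
Sparse⇒Decreasing {d} = Linked.map λ {a} {b} d+b<a → ≤-trans (s≤s (m≤n+m b d)) d+b<a

Decreasing-head> : ∀ {b H} → Decreasing (b ∷ H) → All (_< b) H
Decreasing-head> [-] = []
Decreasing-head> (c<b ∷ l) = Linked⇒All (λ b<a c<b → <-trans c<b b<a) c<b l

beta : List ℕ → List ℕ
beta [] = []
beta (p ∷ rest) = p + length rest ∷ beta rest

unbeta : List ℕ → List ℕ
unbeta [] = []
unbeta (b ∷ H) = b ∸ length H ∷ unbeta H

length-beta : ∀ λs → length (beta λs) ≡ length λs
length-beta [] = refl
length-beta (p ∷ rest) = cong suc (length-beta rest)

length-unbeta : ∀ H → length (unbeta H) ≡ length H
length-unbeta [] = refl
length-unbeta (b ∷ H) = cong suc (length-unbeta H)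

unbeta-beta : ∀ λs → unbeta (beta λs) ≡ λs
unbeta-beta [] = refl
unbeta-beta (p ∷ rest) =
  cong₂ _∷_ (trans (cong (p + length rest ∸_) (length-beta rest)) (m+n∸n≡m p (length rest)))
            (unbeta-beta rest)

beta-< : ∀ {q} rest → All (_≤ q) rest → All (_< q + length rest) (beta rest)
beta-< [] [] = []
beta-< {q} (p ∷ rest) (p≤q ∷ rest≤q) =
  subst (p + length rest <_) (sym (+-suc q (length rest))) (s≤s (+-monoˡ-≤ (length rest) p≤q))
  ∷ All.map (λ c< → ≤-trans c< (≤-trans (n≤1+n _) (≤-reflexive (sym (+-suc q (length rest))))))
            (beta-< rest rest≤q)

countAbove : ℕ → List ℕ → ℕ
countAbove j rest = length (filter (j <?_) rest)

countAbove-≤ : ∀ j rest → All (_≤ j) rest → countAbove j rest ≡ 0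
countAbove-≤ j [] [] = refl
countAbove-≤ j (q ∷ rest) (q≤j ∷ rest≤j) =
  trans (cong length (filter-reject (j <?_) (λ j<q → <⇒≱ j<q q≤j))) (countAbove-≤ j rest rest≤j)

-- definitionally equal to hook (p ∷ rest) fzero j
firstRowHook : ℕ → List ℕ → ℕ → ℕ
firstRowHook p rest j = suc (p ∸ suc j + countAbove j rest)

firstRowHook-offset : ∀ {p} j a rest → p ≡ suc (j + a) → firstRowHook p rest j ≡ suc (a + countAbove j rest)
firstRowHook-offset j a rest refl = cong (λ z → suc (z + countAbove j rest)) (m+n∸m≡n j a)

firstRowHook-below : ∀ e q rest j → j < q → firstRowHook (q + e) (q ∷ rest) j ≡ suc e + firstRowHook q rest j
firstRowHook-below e q rest j j<q with a , refl ← ≤⇒offset j<q = begin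
  firstRowHook (suc (j + a) + e) (q′ ∷ rest) j
    ≡⟨ firstRowHook-offset j (a + e) (q′ ∷ rest) (cong suc (+-assoc j a e)) ⟩
  suc (a + e + countAbove j (q′ ∷ rest))
    ≡⟨ cong (λ z → suc (a + e + length z)) (filter-accept (j <?_) j<q) ⟩
  suc (a + e + suc (countAbove j rest))
    ≡⟨ shuffle a e (countAbove j rest) ⟩
  suc e + suc (a + countAbove j rest)
    ≡⟨ cong (suc e +_) (firstRowHook-offset j a rest refl) ⟨
  suc e + firstRowHook q′ rest j
    ∎
  where
  open ≡-Reasoning
  q′ = suc (j + a)
  shuffle : ∀ a e c → suc (a + e + suc c) ≡ suc e + suc (a + c)
  shuffle = solve-∀

firstRowHook-beyond : ∀ {p} q rest j a → All (_≤ q) rest → q ≤ j → p ≡ suc (j + a) →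
  firstRowHook p (q ∷ rest) j ≡ suc a
firstRowHook-beyond {p} q rest j a rest≤q q≤j p≡ = begin
  firstRowHook p (q ∷ rest) j        ≡⟨ firstRowHook-offset j a (q ∷ rest) p≡ ⟩
  suc (a + countAbove j (q ∷ rest))  ≡⟨ cong (λ z → suc (a + z)) (countAbove-≤ j (q ∷ rest) (q≤j ∷ rest≤j)) ⟩
  suc (a + 0)                        ≡⟨ cong suc (+-identityʳ a) ⟩
  suc a                              ∎
  where
  open ≡-Reasoning
  rest≤j = All.map (λ r≤q → ≤-trans r≤q q≤j) rest≤q

EndsInGap : ℕ → ℕ → List ℕ → Set
EndsInGap h b H = h ≤ b × (∀ c → c ∈ H → h + c ≢ b)

EndsInGap-cons : ∀ k {h b H} → 1 ≤ h → EndsInGap h b H → EndsInGap (k + h) (k + b) (b ∷ H)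
EndsInGap-cons k {suc h} {b} _ (h≤b , avoids) = +-monoʳ-≤ k h≤b , avoids′
  where
  avoids′ : ∀ c → c ∈ b ∷ _ → k + suc h + c ≢ k + b
  avoids′ c (here refl) eq = m≢1+n+m c (sym (+-cancelˡ-≡ k _ _ (trans (sym (+-assoc k (suc h) c)) eq)))
  avoids′ c (there c∈H) eq = avoids c c∈H (+-cancelˡ-≡ k _ _ (trans (sym (+-assoc k (suc h) c)) eq))

EndsInGap-uncons : ∀ k {h b b′ H} → EndsInGap (k + h) (k + b) (b′ ∷ H) → EndsInGap h b H
EndsInGap-uncons k {h} (h≤b , avoids) =
  +-cancelˡ-≤ k _ _ h≤b ,
  λ c c∈H eq → avoids c (there c∈H) (trans (+-assoc k h c) (cong (k +_) eq))

EndsInGap-< : ∀ {h b M H} → h + M ≤ b → All (_< M) H → EndsInGap h b H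
EndsInGap-< {h} {M = M} h+M≤b H<M =
  ≤-trans (m≤m+n h M) h+M≤b ,
  λ c c∈H eq → <⇒≢ (≤-trans (+-monoʳ-< h (All.lookup H<M c∈H)) h+M≤b) eq

private
  beta-head-shift : ∀ q e m → suc e + (q + m) ≡ q + e + suc m
  beta-head-shift = solve-∀

-- The hook lengths in the first row of p ∷ rest are the t ≥ 1 with EndsInGap t (p + length rest) (beta rest),
-- i.e. the distances from the largest β-number down to the gaps of the β-set.
firstRowHook-sound : ∀ p rest → NonIncreasing (p ∷ rest) → ∀ j → j < p →
  EndsInGap (firstRowHook p rest j) (p + length rest) (beta rest)
firstRowHook-sound p [] _ j j<p with a , refl ← ≤⇒offset j<p =
  ≤-trans (≤-reflexive (firstRowHook-offset j a [] refl))
          (subst₂ _≤_ (sym (+-identityʳ (suc a))) (sym (+-identityʳ (suc (j + a)))) (s≤s (m≤n+m a j))) ,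
  λ _ ()
firstRowHook-sound p (q ∷ rest) p≥ j j<p with e , refl ← ≤⇒offset (Linked.head p≥) | j <? q
... | yes j<q =
  subst₂ (λ h b → EndsInGap h b (beta (q ∷ rest)))
         (sym (firstRowHook-below e q rest j j<q)) (beta-head-shift q e (length rest))
         (EndsInGap-cons (suc e) (s≤s z≤n) (firstRowHook-sound q rest (Linked.tail p≥) j j<q))
... | no j≮q with a , p≡ ← ≤⇒offset j<p =
  subst (λ h → EndsInGap h (q + e + suc (length rest)) (beta (q ∷ rest)))
        (sym (firstRowHook-beyond q rest j a rest≤q q≤j p≡))
        (EndsInGap-< (≤-trans (≤-reflexive (sym (+-assoc (suc a) q (suc (length rest)))))
                              (+-monoˡ-≤ (suc (length rest)) 1+a+q≤p))
                     (beta-< (q ∷ rest) (≤-refl ∷ rest≤q)))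
  where
  rest≤q = NonIncreasing-head≥ (Linked.tail p≥)
  q≤j = ≮⇒≥ j≮q
  1+a+q≤p : suc a + q ≤ q + e
  1+a+q≤p = ≤-trans (+-monoʳ-≤ (suc a) q≤j) (≤-reflexive (trans (cong suc (+-comm a j)) (sym p≡)))

firstRowHook-complete : ∀ p rest → NonIncreasing (p ∷ rest) → ∀ t → 1 ≤ t →
  EndsInGap t (p + length rest) (beta rest) → Σ ℕ λ j → j < p × firstRowHook p rest j ≡ t
firstRowHook-complete p [] _ (suc t) _ (t<p , _)
  with k , refl ← ≤⇒offset (subst (suc t ≤_) (+-identityʳ p) t<p) =
  k , s≤s (m≤n+m k t) ,
  trans (firstRowHook-offset k t [] (cong suc (+-comm t k))) (cong suc (+-identityʳ t))
firstRowHook-complete p (q ∷ rest) p≥ (suc t₀) _ gap with e , refl ← ≤⇒offset (Linked.head p≥) | <-cmp t₀ e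
... | tri≈ _ refl _ = ⊥-elim (proj₂ gap (q + length rest) (here refl) (beta-head-shift q e (length rest)))
... | tri> _ _ e<t₀ with k , refl ← ≤⇒offset e<t₀ =
  j , ≤-trans j<q (m≤m+n q e) ,
  trans (firstRowHook-below e q rest j j<q) (trans (cong (suc e +_) hook≡) (cong suc (+-suc e k)))
  where
  gap′ : EndsInGap (suc e + suc k) (suc e + (q + length rest)) (beta (q ∷ rest))
  gap′ = subst₂ (λ h b → EndsInGap h b (beta (q ∷ rest)))
                (cong suc (sym (+-suc e k))) (sym (beta-head-shift q e (length rest))) gap
  IH = firstRowHook-complete q rest (Linked.tail p≥) (suc k) (s≤s z≤n) (EndsInGap-uncons (suc e) gap′)
  j = proj₁ IH
  j<q = proj₁ (proj₂ IH)
  hook≡ = proj₂ (proj₂ IH)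
... | tri< t₀<e _ _ with k , refl ← ≤⇒offset t₀<e =
  q + k , subst (q + k <_) (sym p≡) (s≤s (m≤m+n (q + k) t₀)) ,
  firstRowHook-beyond q rest (q + k) t₀ (NonIncreasing-head≥ (Linked.tail p≥)) (m≤m+n q k) p≡
  where
  shuffle : ∀ q t₀ k → q + (suc t₀ + k) ≡ suc (q + k + t₀)
  shuffle = solve-∀
  p≡ = shuffle q t₀ k

Closed : ℕ → List ℕ → Set
Closed t H = ∀ x → x ∈ H → t ≤ x → x ∸ t ∈ H

∉⇒EndsInGap : ∀ {t b} H → t ≤ b → b ∸ t ∉ H → EndsInGap t b H
∉⇒EndsInGap {t} H t≤b b-t∉ =
  t≤b , λ c c∈ eq → b-t∉ (subst (_∈ H) (trans (sym (m+n∸m≡n t c)) (cong (_∸ t) eq)) c∈)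

firstRowAvoids⇒ : ∀ {t p rest} → NonIncreasing (p ∷ rest) → 1 ≤ t →
  (∀ j → j < p → firstRowHook p rest j ≢ t) →
  t ≤ p + length rest → p + length rest ∸ t ∈ beta rest
firstRowAvoids⇒ {t} {p} {rest} p≥ 1≤t avoids t≤b with p + length rest ∸ t ∈? beta rest
... | yes b-t∈ = b-t∈
... | no b-t∉ with j , j<p , hook≡t ← firstRowHook-complete p rest p≥ t 1≤t (∉⇒EndsInGap (beta rest) t≤b b-t∉) =
  ⊥-elim (avoids j j<p hook≡t)

firstRowAvoids⇐ : ∀ {t p rest} → NonIncreasing (p ∷ rest) →
  (t ≤ p + length rest → p + length rest ∸ t ∈ beta rest) →
  ∀ j → j < p → firstRowHook p rest j ≢ t
firstRowAvoids⇐ {p = p} {rest} p≥ closed j j<p refl with hook≤b , avoids ← firstRowHook-sound p rest p≥ j j<p =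
  avoids _ (closed hook≤b) (m+[n∸m]≡n hook≤b)

IsCore⇒Closed : ∀ t λs → NonIncreasing λs → 1 ≤ t → IsCore t λs → Closed t (beta λs)
IsCore⇒Closed t (p ∷ rest) p≥ 1≤t core x (here refl) t≤x =
  there (firstRowAvoids⇒ p≥ 1≤t (core fzero) t≤x)
IsCore⇒Closed t (p ∷ rest) p≥ 1≤t core x (there x∈) t≤x =
  there (IsCore⇒Closed t rest (Linked.tail p≥) 1≤t (λ i → core (fsuc i)) x x∈ t≤x)

Closed⇒IsCore : ∀ t λs → NonIncreasing λs → 1 ≤ t → Closed t (beta λs) → IsCore t λs
Closed⇒IsCore t (p ∷ rest) p≥ 1≤t closed fzero = firstRowAvoids⇐ p≥ headGap
  where
  headGap : t ≤ p + length rest → p + length rest ∸ t ∈ beta rest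
  headGap t≤b with closed _ (here refl) t≤b
  ... | here eq = ⊥-elim (<⇒≢ (∸-monoʳ-< 1≤t t≤b) eq)
  ... | there b-t∈ = b-t∈
Closed⇒IsCore t (p ∷ rest) p≥ 1≤t closed (fsuc i) =
  Closed⇒IsCore t rest (Linked.tail p≥) 1≤t closedRest i
  where
  closedRest : Closed t (beta rest)
  closedRest x x∈ t≤x with closed x (there x∈) t≤x
  ... | here eq = ⊥-elim (<⇒≢ (≤-<-trans (m∸n≤m x t) (All.lookup (beta-< rest (NonIncreasing-head≥ p≥)) x∈)) eq)
  ... | there x-t∈ = x-t∈

beta-sparse : ∀ {d} λs → DDistinct d λs → Sparse d (beta λs)
beta-sparse [] [] = []
beta-sparse (p ∷ []) [-] = [-]
beta-sparse {d} (p ∷ q ∷ rest) (d+q≤p ∷ l) =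
  subst (_≤ p + suc (length rest)) (shuffle d q (length rest)) (+-monoˡ-≤ (suc (length rest)) d+q≤p)
  ∷ beta-sparse (q ∷ rest) l
  where
  shuffle : ∀ d q m → d + q + suc m ≡ suc (d + (q + m))
  shuffle = solve-∀

beta-positive : ∀ λs → All (1 ≤_) λs → All (1 ≤_) (beta λs)
beta-positive [] [] = []
beta-positive (p ∷ rest) (1≤p ∷ rest≥1) = ≤-trans 1≤p (m≤m+n p (length rest)) ∷ beta-positive rest rest≥1

length<head : ∀ b H → Decreasing (b ∷ H) → All (1 ≤_) (b ∷ H) → length H < b
length<head b [] _ (1≤b ∷ []) = 1≤b
length<head b (c ∷ H) (c<b ∷ dec) (_ ∷ pos) = ≤-<-trans (length<head c H dec pos) c<b

beta-unbeta : ∀ H → Decreasing H → All (1 ≤_) H → beta (unbeta H) ≡ H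
beta-unbeta [] _ _ = refl
beta-unbeta (b ∷ H) dec pos =
  cong₂ _∷_ (trans (cong (b ∸ length H +_) (length-unbeta H)) (m∸n+n≡m (<⇒≤ (length<head b H dec pos))))
            (beta-unbeta H (Linked.tail dec) (All.tail pos))

unbeta-positive : ∀ H → Decreasing H → All (1 ≤_) H → All (1 ≤_) (unbeta H)
unbeta-positive [] _ _ = []
unbeta-positive (b ∷ H) dec pos =
  m<n⇒0<n∸m (length<head b H dec pos) ∷ unbeta-positive H (Linked.tail dec) (All.tail pos)

unbeta-ddistinct : ∀ {d} H → Sparse d H → All (1 ≤_) H → DDistinct d (unbeta H)
unbeta-ddistinct [] _ _ = []
unbeta-ddistinct (b ∷ []) _ _ = [-]
unbeta-ddistinct {d} (b ∷ c ∷ H) sparse@(d+c<b ∷ sparse′) pos@(_ ∷ pos′) =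
  +-cancelʳ-≤ (suc k) _ _ (subst₂ _≤_ (sym d+[c-k]+1+k≡1+d+c) (sym (m∸n+n≡m (<⇒≤ 1+k<b))) d+c<b)
  ∷ unbeta-ddistinct (c ∷ H) sparse′ pos′
  where
  k = length H
  k<c = length<head c H (Sparse⇒Decreasing sparse′) pos′
  1+k<b = length<head b (c ∷ H) (Sparse⇒Decreasing sparse) pos
  d+[c-k]+1+k≡1+d+c : d + (c ∸ k) + suc k ≡ suc (d + c)
  d+[c-k]+1+k≡1+d+c = begin
    d + (c ∸ k) + suc k      ≡⟨ +-suc (d + (c ∸ k)) k ⟩
    suc (d + (c ∸ k) + k)    ≡⟨ cong suc (+-assoc d (c ∸ k) k) ⟩
    suc (d + (c ∸ k + k))    ≡⟨ cong (λ z → suc (d + z)) (m∸n+n≡m (<⇒≤ k<c)) ⟩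
    suc (d + c)              ∎
    where open ≡-Reasoning

DDistinct⇒NonIncreasing : ∀ {d λs} → DDistinct d λs → NonIncreasing λs
DDistinct⇒NonIncreasing {d} = Linked.map λ {a} {b} d+b≤a → ≤-trans (m≤n+m b d) d+b≤a

-- β-sets of (s, s + ns − 1)-cores

record BetaSet (d n s : ℕ) (H : List ℕ) : Set where
  field
    sparse   : Sparse d H
    positive : All (1 ≤_) H
    closed   : Closed s H
    bounded  : All (_< s + (n * s ∸ 1)) H

Sparse⇒apart : ∀ {d H x y} → Sparse d H → x ∈ H → y ∈ H → x < y → d + x < y
Sparse⇒apart {d} sparse = go (Linked⇒AllPairs trans′ sparse)
  where
  trans′ : ∀ {a b c} → d + b < a → d + c < b → d + c < a
  trans′ {b = b} {c} d+b<a d+c<b = <-trans (<-≤-trans d+c<b (m≤n+m b d)) d+b<a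
  go : ∀ {H x y} → AllPairs (λ a b → d + b < a) H → x ∈ H → y ∈ H → x < y → d + x < y
  go (_ ∷ _) (here refl) (here refl) x<y = ⊥-elim (<-irrefl refl x<y)
  go {y = y} (apart ∷ _) (here refl) (there y∈) x<y =
    ⊥-elim (<-asym x<y (≤-<-trans (m≤n+m y d) (All.lookup apart y∈)))
  go (apart ∷ _) (there x∈) (here refl) _ = All.lookup apart x∈
  go (_ ∷ pairs) (there x∈) (there y∈) x<y = go pairs x∈ y∈ x<y

Closed-* : ∀ {s H} → Closed s H → ∀ k → Closed (k * s) H
Closed-* closed zero x x∈ _ = x∈
Closed-* {s} {H} closed (suc k) x x∈ s+ks≤x =
  subst (_∈ H) (∸-+-assoc x s (k * s))
    (Closed-* closed k (x ∸ s) (closed x x∈ (≤-trans (m≤m+n s (k * s)) s+ks≤x))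
      (subst (_≤ x ∸ s) (m+n∸m≡n s (k * s)) (∸-monoˡ-≤ s s+ks≤x)))

Closed⇒¬[u,u+s-1] : ∀ {d s₀ H u} → 1 ≤ d → Sparse d H → All (1 ≤_) H → Closed (suc s₀) H →
  u ∈ H → s₀ + u ∈ H → ⊥
Closed⇒¬[u,u+s-1] {u = zero} _ _ positive _ 0∈ _ = <-irrefl refl (All.lookup positive 0∈)
Closed⇒¬[u,u+s-1] {d} {s₀} {H} {suc u} 1≤d sparse _ closed 1+u∈ s₀+1+u∈ =
  1+n≰n (≤-trans (s≤s (+-monoˡ-≤ u 1≤d)) (Sparse⇒apart sparse u∈ 1+u∈ ≤-refl))
  where
  u∈ : u ∈ H
  u∈ = subst (_∈ H) (trans (cong (_∸ suc s₀) (+-suc s₀ u)) (m+n∸m≡n (suc s₀) u))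
             (closed (s₀ + suc u) s₀+1+u∈ (subst (suc s₀ ≤_) (sym (+-suc s₀ u)) (s≤s (m≤m+n s₀ u))))

-- A bead x ≥ s + (n s − 1) yields the beads x − (s + n s − 1) and x − n s, which differ by s − 1.
closed₂⇒bounded : ∀ {d n s H} → 1 ≤ d → 1 ≤ n → 1 ≤ s → Sparse d H → All (1 ≤_) H →
  Closed s H → Closed (s + (n * s ∸ 1)) H → All (_< s + (n * s ∸ 1)) H
closed₂⇒bounded {d} {suc n₀} {suc s₀} {H} 1≤d _ _ sparse positive closedₛ closedₜ = All.tabulate below
  where
  s = suc s₀
  k = s₀ + n₀ * s
  t = s + k
  below : ∀ {x} → x ∈ H → x < t
  below {x} x∈ with x <? t
  ... | yes x<t = x<t
  ... | no x≮t with u , refl ← ≤⇒offset (≮⇒≥ x≮t) =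
    ⊥-elim (Closed⇒¬[u,u+s-1] 1≤d sparse positive closedₛ u∈ s₀+u∈)
    where
    u∈ : u ∈ H
    u∈ = subst (_∈ H) (m+n∸m≡n t u) (closedₜ (t + u) x∈ (m≤m+n t u))
    shuffle : ∀ s₀ k u → suc s₀ + k + u ≡ suc k + (s₀ + u)
    shuffle = solve-∀
    s₀+u∈ : s₀ + u ∈ H
    s₀+u∈ = subst (_∈ H) (trans (cong (_∸ suc k) (shuffle s₀ k u)) (m+n∸m≡n (suc k) (s₀ + u)))
              (Closed-* closedₛ (suc n₀) (t + u) x∈ (≤-trans (s≤s (m≤n+m k s₀)) (m≤m+n t u)))

CoreDDistinct⇒BetaSet : ∀ {d n s λs} → 1 ≤ d → 1 ≤ n → 1 ≤ s →
  CoreDDistinct d (n * s ∸ 1) s λs → BetaSet d n s (beta λs)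
CoreDDistinct⇒BetaSet {d} {n} {s} {λs} 1≤d 1≤n 1≤s ((positive , λs≥) , coreₛ , coreₜ , distinct) = record
  { sparse   = sparse
  ; positive = positive′
  ; closed   = closedₛ
  ; bounded  = closed₂⇒bounded 1≤d 1≤n 1≤s sparse positive′ closedₛ
                 (IsCore⇒Closed _ λs λs≥ (≤-trans 1≤s (m≤m+n s _)) coreₜ)
  }
  where
  sparse = beta-sparse λs distinct
  positive′ = beta-positive λs positive
  closedₛ = IsCore⇒Closed s λs λs≥ 1≤s coreₛ

BetaSet⇒CoreDDistinct : ∀ {d n s H} → 1 ≤ s → BetaSet d n s H → CoreDDistinct d (n * s ∸ 1) s (unbeta H)
BetaSet⇒CoreDDistinct {d} {n} {s} {H} 1≤s B =
  (unbeta-positive H decreasing positive , λs≥) ,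
  Closed⇒IsCore s (unbeta H) λs≥ 1≤s (subst (Closed s) (sym beta∘unbeta) closed) ,
  Closed⇒IsCore t (unbeta H) λs≥ (≤-trans 1≤s (m≤m+n s _)) (subst (Closed t) (sym beta∘unbeta) vacuous) ,
  distinct
  where
  open BetaSet B
  t = s + (n * s ∸ 1)
  decreasing = Sparse⇒Decreasing sparse
  distinct = unbeta-ddistinct H sparse positive
  λs≥ = DDistinct⇒NonIncreasing distinct
  beta∘unbeta = beta-unbeta H decreasing positive
  vacuous : Closed t H
  vacuous x x∈ t≤x = ⊥-elim (<⇒≱ (All.lookup bounded x∈) t≤x)

betaSet-count : ∀ {d n s k} → 1 ≤ d → 1 ≤ n → 1 ≤ s → HasCount (BetaSet d n s) k → N≡ d (n * s ∸ 1) s k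
betaSet-count {d} {n} {s} 1≤d 1≤n 1≤s =
  HasCount-bijection unbeta beta
    (λ H → BetaSet⇒CoreDDistinct 1≤s)
    (λ λs → CoreDDistinct⇒BetaSet 1≤d 1≤n 1≤s)
    (λ H B → beta-unbeta H (Sparse⇒Decreasing (BetaSet.sparse B)) (BetaSet.positive B))
    (λ λs _ → unbeta-beta λs)

-- Abaci

-- list lookup, with 0 beyond the end
at : List ℕ → ℕ → ℕ
at [] _ = 0
at (x ∷ xs) zero = x
at (x ∷ xs) (suc i) = at xs i

at-injective : ∀ w w′ → length w ≡ length w′ → (∀ a → a < length w → at w a ≡ at w′ a) → w ≡ w′
at-injective [] [] _ _ = refl
at-injective (x ∷ w) (y ∷ w′) len≡ at≡ =
  cong₂ _∷_ (at≡ 0 (s≤s z≤n)) (at-injective w w′ (suc-injective len≡) (λ a a< → at≡ (suc a) (s≤s a<)))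

at-applyUpTo : ∀ f m a → a < m → at (applyUpTo f m) a ≡ f a
at-applyUpTo f (suc m) zero _ = refl
at-applyUpTo f (suc m) (suc a) (s≤s a<m) = at-applyUpTo (λ i → f (suc i)) m a a<m

∀<? : {P : ℕ → Set} → (∀ i → Dec (P i)) → ∀ m → Dec (∀ i → i < m → P i)
∀<? P? zero = yes (λ i ())
∀<? {P} P? (suc m) with ∀<? P? m | P? m
... | no ¬all | _ = no (λ all → ¬all (λ i i<m → all i (m<n⇒m<1+n i<m)))
... | yes _ | no ¬Pm = no (λ all → ¬Pm (all m ≤-refl))
... | yes all | yes Pm = yes λ i i<1+m → [ all i , (λ { refl → Pm }) ]′ (m<1+n⇒m<n∨m≡n i<1+m)

∃<? : {P : ℕ → Set} → (∀ i → Dec (P i)) → ∀ m → Dec (Σ ℕ λ i → i < m × P i)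
∃<? P? zero = no (λ { (_ , () , _) })
∃<? {P} P? (suc m) with ∃<? P? m | P? m
... | yes (i , i<m , Pi) | _ = yes (i , m<n⇒m<1+n i<m , Pi)
... | no _ | yes Pm = yes (m , ≤-refl , Pm)
... | no ¬any | no ¬Pm = no λ { (i , i<1+m , Pi) →
  [ (λ i<m → ¬any (i , i<m , Pi)) , (λ { refl → ¬Pm Pi }) ]′ (m<1+n⇒m<n∨m≡n i<1+m) }

-- An abacus with s runners: runner a carries the beads a, a + s, …, a + (at w a − 1) s. beads≤ and lastBeads≤
-- keep all beads below s + (n s − 1); sameLevel and nextLevel say that beads on the same row, resp. on
-- consecutive rows, are more than d apart.
record Abacus (d n s : ℕ) (w : List ℕ) : Set where
  field
    length≡    : length w ≡ s
    firstEmpty : at w 0 ≡ 0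
    beads≤     : ∀ a → a < s → at w a ≤ suc n
    lastBeads≤ : at w (s ∸ 1) ≤ n
    sameLevel  : ∀ b → b < s → ∀ a → a < b → b ≤ a + d → at w a ≡ 0 ⊎ at w b ≡ 0
    nextLevel  : ∀ b → b < s → ∀ a → a < s → a + s ≤ b + d → at w a ≤ 1 ⊎ at w b ≡ 0

Bead : ℕ → List ℕ → ℕ → Set
Bead s w x = Σ ℕ λ a → a < s × Σ ℕ λ j → j < at w a × x ≡ a + j * s

Bead? : ∀ s w x → Dec (Bead s w x)
Bead? s w x = ∃<? (λ a → ∃<? (λ j → x ≟ a + j * s) (at w a)) s

beads : ℕ → ℕ → List ℕ → List ℕ
beads n s w = filter (Bead? s w) (downFrom (suc n * s))

+*-injective : ∀ {s a j a′ j′} .{{_ : NonZero s}} → a < s → a′ < s →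
  a + j * s ≡ a′ + j′ * s → a ≡ a′ × j ≡ j′
+*-injective {s} {a} {j} {a′} {j′} a<s a′<s eq =
  a≡a′ , *-cancelʳ-≡ j j′ s (+-cancelˡ-≡ a _ _ (trans eq (cong (_+ j′ * s) (sym a≡a′))))
  where
  open ≡-Reasoning
  a≡a′ : a ≡ a′
  a≡a′ = begin
    a                  ≡⟨ m<n⇒m%n≡m a<s ⟨
    a % s              ≡⟨ [m+kn]%n≡m%n a j s ⟨
    (a + j * s) % s    ≡⟨ cong (_% s) eq ⟩
    (a′ + j′ * s) % s  ≡⟨ [m+kn]%n≡m%n a′ j′ s ⟩
    a′ % s             ≡⟨ m<n⇒m%n≡m a′<s ⟩
    a′                 ∎

Bead-positive : ∀ {s w x} → at w 0 ≡ 0 → Bead s w x → 1 ≤ x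
Bead-positive empty (zero , _ , j , j< , _) = ⊥-elim (n≮0 (subst (j <_) empty j<))
Bead-positive empty (suc a , _ , j , _ , refl) = s≤s z≤n

Bead-closed : ∀ {s w x} → Bead s w x → s ≤ x → Bead s w (x ∸ s)
Bead-closed (a , a<s , zero , _ , refl) s≤x = ⊥-elim (<⇒≱ a<s (subst (_ ≤_) (+-identityʳ a) s≤x))
Bead-closed {s} (a , a<s , suc j , 1+j< , refl) _ = a , a<s , j , <-trans (n<1+n j) 1+j< , x-s≡
  where
  x-s≡ : a + (s + j * s) ∸ s ≡ a + j * s
  x-s≡ = trans (cong (_∸ s) (+-comm a (s + j * s))) (trans (cong (_∸ s) (+-assoc s (j * s) a))
           (trans (m+n∸m≡n s (j * s + a)) (+-comm (j * s) a)))

Bead-bounded : ∀ {d n s w x} → 1 ≤ n → Abacus d n s w → Bead s w x → x < s + (n * s ∸ 1)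
Bead-bounded {s = zero} _ _ (_ , () , _)
Bead-bounded {n = suc n₀} {suc s₀} {w} _ A (a , a<s , j , j< , refl) =
  subst (a + j * s <_) (+-suc s₀ (s₀ + n₀ * s)) bead<
  where
  open Abacus A
  s = suc s₀
  n = suc n₀
  bead< : a + j * s < s₀ + n * s
  bead< with a ≟ s₀
  ... | yes refl = +-monoʳ-< s₀ (≤-trans (s≤s (m≤n+m (j * s) s₀)) (*-monoˡ-≤ s (≤-trans j< lastBeads≤)))
  ... | no a≢s₀ =
    +-mono-<-≤ (≤∧≢⇒< (≤-pred a<s) a≢s₀) (*-monoˡ-≤ s (≤-pred (≤-trans j< (beads≤ a a<s))))

Bead-apart : ∀ {d n s w x y} → Abacus d n s w → d < s → Bead s w x → Bead s w y → y < x → d + y < x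
Bead-apart {d} {n} {s} {w} A d<s (a , a<s , j , j< , refl) (a′ , a′<s , j′ , j′< , refl) y<x with j′ ≤? j
... | no j′≰j = ⊥-elim (<-asym y<x (≤-trans (+-monoˡ-< (j * s) a<s)
                  (≤-trans (*-monoˡ-≤ s (≰⇒> j′≰j)) (m≤n+m (j′ * s) a′))))
... | yes j′≤j with k , refl ← ≤⇒offset j′≤j =
  subst₂ _<_ (+-assoc d a′ (j′ * s)) (shuffle a j′ k s) (+-monoˡ-< (j′ * s) (rowsApart k j< a′<a+ks))
  where
  open Abacus A
  shuffle : ∀ a j k s → a + k * s + j * s ≡ a + (j + k) * s
  shuffle = solve-∀
  a′<a+ks : a′ < a + k * s
  a′<a+ks = +-cancelʳ-< (j′ * s) a′ (a + k * s) (subst (a′ + j′ * s <_) (sym (shuffle a j′ k s)) y<x)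
  nonEmpty : ∀ {i b} → i < at w b → at w b ≢ 0
  nonEmpty {i} i< empty = n≮0 (subst (i <_) empty i<)
  rowsApart : ∀ k → j′ + k < at w a → a′ < a + k * s → d + a′ < a + k * s
  rowsApart zero _ a′<a+0 with a ≤? a′ + d
  ... | yes a≤a′+d = ⊥-elim ([ nonEmpty j′< , nonEmpty j< ]′
          (sameLevel a a<s a′ (subst (a′ <_) (+-identityʳ a) a′<a+0) a≤a′+d))
  ... | no a≰a′+d = subst₂ _<_ (+-comm a′ d) (sym (+-identityʳ a)) (≰⇒> a≰a′+d)
  rowsApart (suc zero) j′+1< _ with a + s ≤? a′ + d
  ... | yes a+s≤a′+d = ⊥-elim ([ <⇒≱ (≤-<-trans (m≤n+m 1 j′) j′+1<) , nonEmpty j′< ]′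
          (nextLevel a′ a′<s a a<s a+s≤a′+d))
  ... | no a+s≰a′+d = subst₂ _<_ (+-comm a′ d) (cong (a +_) (sym (+-identityʳ s))) (≰⇒> a+s≰a′+d)
  rowsApart (suc (suc k)) _ _ =
    ≤-trans (+-mono-< d<s a′<s) (≤-trans (m≤m+n (s + s) (k * s))
      (≤-trans (≤-reflexive (+-assoc s s (k * s))) (m≤n+m _ a)))

Linked-refine : ∀ {P : ℕ → Set} {R S : ℕ → ℕ → Set} {xs} →
  (∀ {x y} → P x → P y → R x y → S x y) → All P xs → Linked R xs → Linked S xs
Linked-refine f _ [] = []
Linked-refine f _ [-] = [-]
Linked-refine f (Px ∷ Py ∷ Ps) (Rxy ∷ l) = f Px Py Rxy ∷ Linked-refine f (Py ∷ Ps) l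

∈beads⇒Bead : ∀ n s w {x} → x ∈ beads n s w → Bead s w x
∈beads⇒Bead n s w x∈ = proj₂ (∈-filter⁻ (Bead? s w) {xs = downFrom (suc n * s)} x∈)

Bead⇒∈beads : ∀ {d n s w x} → 1 ≤ n → Abacus d n s w → Bead s w x → x ∈ beads n s w
Bead⇒∈beads {n = n} {s} {w} 1≤n A bead =
  ∈-filter⁺ (Bead? s w) (∈-downFrom⁺ (<-≤-trans (Bead-bounded 1≤n A bead) (+-monoʳ-≤ s (m∸n≤m (n * s) 1)))) bead

beads-decreasing : ∀ n s w → Decreasing (beads n s w)
beads-decreasing n s w =
  Linked-filter⁺ (Bead? s w) (λ b<a c<b → <-trans c<b b<a)
    (Linked-applyDownFrom⁺₂ id (suc n * s) (λ _ → ≤-refl))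

beads-betaSet : ∀ {d n s w} → 1 ≤ n → d < s → Abacus d n s w → BetaSet d n s (beads n s w)
beads-betaSet {d} {n} {s} {w} 1≤n d<s A = record
  { sparse   = Linked-refine {P = Bead s w} (Bead-apart A d<s) onAbacus (beads-decreasing n s w)
  ; positive = All.map {P = Bead s w} (Bead-positive {s} {w} (Abacus.firstEmpty A)) onAbacus
  ; closed   = λ x x∈ s≤x → Bead⇒∈beads 1≤n A (Bead-closed {s} {w} (∈beads⇒Bead n s w x∈) s≤x)
  ; bounded  = All.map {P = Bead s w} (Bead-bounded 1≤n A) onAbacus
  }
  where
  onAbacus : All (Bead s w) (beads n s w)
  onAbacus = All.tabulate (∈beads⇒Bead n s w)

chainLength : List ℕ → ℕ → ℕ → ℕ → ℕ
chainLength H s zero y = 0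
chainLength H s (suc f) y with y ∈? H
... | yes _ = suc (chainLength H s f (y + s))
... | no _ = 0

runners : ℕ → ℕ → List ℕ → List ℕ
runners n s H = applyUpTo (chainLength H s (suc n)) s

chainLength-≤ : ∀ H s f y → chainLength H s f y ≤ f
chainLength-≤ H s zero y = z≤n
chainLength-≤ H s (suc f) y with y ∈? H
... | yes _ = s≤s (chainLength-≤ H s f (y + s))
... | no _ = z≤n

chainLength-∉ : ∀ H s f y → y ∉ H → chainLength H s f y ≡ 0
chainLength-∉ H s zero y _ = refl
chainLength-∉ H s (suc f) y y∉ with y ∈? H
... | yes y∈ = ⊥-elim (y∉ y∈)
... | no _ = refl

chainLength-∈ : ∀ H s f y j → j < chainLength H s f y → y + j * s ∈ H
chainLength-∈ H s (suc f) y j j< with y ∈? H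
chainLength-∈ H s (suc f) y zero _ | yes y∈ = subst (_∈ H) (sym (+-identityʳ y)) y∈
chainLength-∈ H s (suc f) y (suc j) j< | yes _ =
  subst (_∈ H) (+-assoc y s (j * s)) (chainLength-∈ H s f (y + s) j (≤-pred j<))

chainLength-complete : ∀ H s f y →
  (∀ j → y + suc j * s ∈ H → y + j * s ∈ H) → (∀ j → y + j * s ∈ H → j < f) →
  ∀ j → y + j * s ∈ H → j < chainLength H s f y
chainLength-complete H s zero y _ bounded j y+js∈ = ⊥-elim (n≮0 (bounded j y+js∈))
chainLength-complete H s (suc f) y downward bounded j y+js∈ with y ∈? H
... | no y∉ = ⊥-elim (y∉ (subst (_∈ H) (+-identityʳ y) (bottom j y+js∈)))
  where
  bottom : ∀ j → y + j * s ∈ H → y + 0 * s ∈ H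
  bottom zero y∈ = y∈
  bottom (suc j) y+[1+j]s∈ = bottom j (downward j y+[1+j]s∈)
... | yes _ with j
...   | zero = s≤s z≤n
...   | suc j′ = s≤s (chainLength-complete H s f (y + s) downward′ bounded′ j′ (shift {j′} y+js∈))
  where
  shift : ∀ {j} → y + (s + j * s) ∈ H → y + s + j * s ∈ H
  shift {j} = subst (_∈ H) (sym (+-assoc y s (j * s)))
  unshift : ∀ {j} → y + s + j * s ∈ H → y + (s + j * s) ∈ H
  unshift {j} = subst (_∈ H) (+-assoc y s (j * s))
  downward′ : ∀ j → y + s + suc j * s ∈ H → y + s + j * s ∈ H
  downward′ j y∈ = shift {j} (downward (suc j) (unshift {suc j} y∈))
  bounded′ : ∀ j → y + s + j * s ∈ H → j < f
  bounded′ j y∈ = ≤-pred (bounded (suc j) (unshift {j} y∈))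

chainLength-≡ : ∀ H s f y h → h ≤ f →
  (∀ j → y + j * s ∈ H → j < h) → (∀ j → j < h → y + j * s ∈ H) → chainLength H s f y ≡ h
chainLength-≡ H s f y h h≤f on⇒< <⇒on = ≤-antisym chain≤h (h≤chain h h≤f on⇒< <⇒on)
  where
  chain≤h : chainLength H s f y ≤ h
  chain≤h with chainLength H s f y | chainLength-∈ H s f y
  ... | zero | _ = z≤n
  ... | suc c | on = on⇒< c (on c ≤-refl)
  h≤chain : ∀ h → h ≤ f → (∀ j → y + j * s ∈ H → j < h) → (∀ j → j < h → y + j * s ∈ H) →
    h ≤ chainLength H s f y
  h≤chain zero _ _ _ = z≤n
  h≤chain (suc h′) h≤f on⇒< <⇒on =
    chainLength-complete H s f y (λ j y+[1+j]s∈ → <⇒on j (<-trans (n<1+n j) (on⇒< (suc j) y+[1+j]s∈)))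
      (λ j y+js∈ → <-≤-trans (on⇒< j y+js∈) h≤f) h′ (<⇒on h′ ≤-refl)

runners-abacus : ∀ {d n s H} → 1 ≤ n → 1 ≤ s → BetaSet d n s H → Abacus d n s (runners n s H)
runners-abacus {d} {suc n₀} {suc s₀} {H} _ _ B = record
  { length≡    = length-applyUpTo chain s
  ; firstEmpty = trans (at≡ 0 (s≤s z≤n)) (chainLength-∉ H s (suc n) 0 (λ 0∈ → n≮0 (All.lookup positive 0∈)))
  ; beads≤     = beads≤
  ; lastBeads≤ = lastBeads≤
  ; sameLevel  = sameLevel
  ; nextLevel  = nextLevel
  }
  where
  open BetaSet B
  n = suc n₀
  s = suc s₀
  w = runners n s H
  chain = chainLength H s (suc n)
  at≡ : ∀ a → a < s → at w a ≡ chain a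
  at≡ = at-applyUpTo chain s
  occupied : ∀ {a} → a < s → at w a ≢ 0 → a ∈ H
  occupied {a} a<s nonEmpty =
    subst (_∈ H) (+-identityʳ a) (chainLength-∈ H s (suc n) a 0 (subst (0 <_) (at≡ a a<s) (n≢0⇒n>0 nonEmpty)))
  beads≤ : ∀ a → a < s → at w a ≤ suc n
  beads≤ a a<s = subst (_≤ suc n) (sym (at≡ a a<s)) (chainLength-≤ H s (suc n) a)
  lastBeads≤ : at w s₀ ≤ n
  lastBeads≤ with m≤n⇒m<n∨m≡n (beads≤ s₀ ≤-refl)
  ... | inj₁ < = ≤-pred <
  ... | inj₂ full = ⊥-elim (<-irrefl (+-suc s₀ (s₀ + n₀ * s))
          (All.lookup bounded (chainLength-∈ H s (suc n) s₀ n (subst (n <_) (trans (sym full) (at≡ s₀ ≤-refl)) ≤-refl))))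
  sameLevel : ∀ b → b < s → ∀ a → a < b → b ≤ a + d → at w a ≡ 0 ⊎ at w b ≡ 0
  sameLevel b b<s a a<b b≤a+d with at w a ≟ 0 | at w b ≟ 0
  ... | yes empty | _ = inj₁ empty
  ... | no _ | yes empty = inj₂ empty
  ... | no a≠ | no b≠ =
    ⊥-elim (<⇒≱ (Sparse⇒apart sparse (occupied (<-trans a<b b<s) a≠) (occupied b<s b≠) a<b)
                (subst (b ≤_) (+-comm a d) b≤a+d))
  nextLevel : ∀ b → b < s → ∀ a → a < s → a + s ≤ b + d → at w a ≤ 1 ⊎ at w b ≡ 0
  nextLevel b b<s a a<s a+s≤b+d with at w a ≤? 1 | at w b ≟ 0
  ... | yes ≤1 | _ = inj₁ ≤1
  ... | no _ | yes empty = inj₂ empty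
  ... | no a≰1 | no b≠ = ⊥-elim (<⇒≱ (Sparse⇒apart sparse (occupied b<s b≠) a+s∈ (≤-trans b<s (m≤n+m s a)))
                                     (subst (a + s ≤_) (+-comm b d) a+s≤b+d))
    where
    a+s∈ : a + s ∈ H
    a+s∈ = subst (_∈ H) (cong (a +_) (+-identityʳ s))
             (chainLength-∈ H s (suc n) a 1 (subst (1 <_) (at≡ a a<s) (≰⇒> a≰1)))

Decreasing-≡ : ∀ {xs ys} → Decreasing xs → Decreasing ys →
  (∀ z → z ∈ xs → z ∈ ys) → (∀ z → z ∈ ys → z ∈ xs) → xs ≡ ys
Decreasing-≡ {[]} {[]} _ _ _ _ = refl
Decreasing-≡ {[]} {y ∷ ys} _ _ _ ys⊆ with () ← ys⊆ y (here refl)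
Decreasing-≡ {x ∷ xs} {[]} _ _ xs⊆ _ with () ← xs⊆ x (here refl)
Decreasing-≡ {x ∷ xs} {y ∷ ys} dx dy xs⊆ ys⊆ =
  cong₂ _∷_ x≡y (Decreasing-≡ (Linked.tail dx) (Linked.tail dy)
                  (shrink xs⊆ x<xs y<ys x≡y) (shrink ys⊆ y<ys x<xs (sym x≡y)))
  where
  x<xs = Decreasing-head> dx
  y<ys = Decreasing-head> dy
  head≤ : ∀ {x y xs ys} → x ∈ y ∷ ys → All (_< y) ys → x ≤ y
  head≤ (here refl) _ = ≤-refl
  head≤ (there x∈) y>ys = <⇒≤ (All.lookup y>ys x∈)
  x≡y = ≤-antisym (head≤ {xs = xs} (xs⊆ x (here refl)) y<ys) (head≤ {xs = ys} (ys⊆ y (here refl)) x<xs)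
  shrink : ∀ {x y xs ys} → (∀ z → z ∈ x ∷ xs → z ∈ y ∷ ys) → All (_< x) xs → All (_< y) ys → x ≡ y →
    ∀ z → z ∈ xs → z ∈ ys
  shrink ⊆ x>xs _ refl z z∈ with ⊆ z (there z∈)
  ... | here refl = ⊥-elim (<-irrefl refl (All.lookup x>xs z∈))
  ... | there z∈ys = z∈ys

runners∘beads : ∀ {d n s w} → 1 ≤ n → 1 ≤ s → Abacus d n s w → runners n s (beads n s w) ≡ w
runners∘beads {d} {n} {suc s₀} {w} 1≤n _ A =
  at-injective _ w (trans (length-applyUpTo chain s) (sym length≡)) λ a a< →
    let a<s = subst (a <_) (length-applyUpTo chain s) a< in
    trans (at-applyUpTo chain s a a<s)
          (chainLength-≡ (beads n s w) s (suc n) a (at w a) (beads≤ a a<s) (onRunner⇒< a<s)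
            (λ j j< → Bead⇒∈beads 1≤n A (a , a<s , j , j< , refl)))
  where
  open Abacus A
  s = suc s₀
  chain = chainLength (beads n s w) s (suc n)
  onRunner⇒< : ∀ {a} → a < s → ∀ j → a + j * s ∈ beads n s w → j < at w a
  onRunner⇒< {a} a<s j on with a′ , a′<s , j′ , j′< , eq ← ∈beads⇒Bead n s w on
    with refl , refl ← +*-injective {s} {a} {j} {a′} {j′} a<s a′<s eq = j′<

beads∘runners : ∀ {d n s H} → 1 ≤ n → 1 ≤ s → BetaSet d n s H → beads n s (runners n s H) ≡ H
beads∘runners {d} {n} {suc s₀} {H} 1≤n 1≤s B =
  Decreasing-≡ (beads-decreasing n s w) (Sparse⇒Decreasing sparse) beads⊆H H⊆beads
  where
  open BetaSet B
  s = suc s₀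
  w = runners n s H
  chain = chainLength H s (suc n)
  beads⊆H : ∀ x → x ∈ beads n s w → x ∈ H
  beads⊆H x x∈ with a , a<s , j , j< , refl ← ∈beads⇒Bead n s w x∈ =
    chainLength-∈ H s (suc n) a j (subst (j <_) (at-applyUpTo chain s a a<s) j<)
  H⊆beads : ∀ x → x ∈ H → x ∈ beads n s w
  H⊆beads x x∈ = Bead⇒∈beads 1≤n (runners-abacus 1≤n 1≤s B) (a , a<s , j , j< , x≡)
    where
    a = x % s
    j = x / s
    a<s = m%n<n x s
    x≡ = m≡m%n+[m/n]*n x s
    downward : ∀ i → a + suc i * s ∈ H → a + i * s ∈ H
    downward i y∈ = subst (_∈ H) y-s≡ (closed _ y∈ (≤-trans (m≤m+n s (i * s)) (m≤n+m _ a)))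
      where
      y-s≡ : a + (s + i * s) ∸ s ≡ a + i * s
      y-s≡ = trans (cong (_∸ s) (shuffle a s (i * s))) (m+n∸m≡n s (a + i * s))
        where
        shuffle : ∀ a s is → a + (s + is) ≡ s + (a + is)
        shuffle = solve-∀
    below : ∀ i → a + i * s ∈ H → i < suc n
    below i y∈ with i <? suc n
    ... | yes i< = i<
    ... | no i≮ = ⊥-elim (<⇒≱ (All.lookup bounded y∈)
            (≤-trans (+-monoʳ-≤ s (m∸n≤m (n * s) 1)) (≤-trans (*-monoˡ-≤ s (≮⇒≥ i≮)) (m≤n+m (i * s) a))))
    j< : j < at w a
    j< = subst (j <_) (sym (at-applyUpTo chain s a a<s))
           (chainLength-complete H s (suc n) a downward below j (subst (_∈ H) x≡ x∈))

abacus-count : ∀ {d n s k} → 1 ≤ n → d < s → HasCount (Abacus d n s) k → HasCount (BetaSet d n s) k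
abacus-count {n = n} {s} 1≤n d<s =
  HasCount-bijection (beads n s) (runners n s)
    (λ _ → beads-betaSet 1≤n d<s) (λ _ → runners-abacus 1≤n 1≤s)
    (λ _ → runners∘beads 1≤n 1≤s) (λ _ → beads∘runners 1≤n 1≤s)
  where
  1≤s = ≤-trans (s≤s z≤n) d<s

Abacus? : ∀ d n s w → Dec (Abacus d n s w)
Abacus? d n s w =
  map′ (λ (l , e , b , t , g₁ , g₂) → record
         { length≡ = l ; firstEmpty = e ; beads≤ = b ; lastBeads≤ = t ; sameLevel = g₁ ; nextLevel = g₂ })
       (λ A → let open Abacus A in length≡ , firstEmpty , beads≤ , lastBeads≤ , sameLevel , nextLevel)
       (length w ≟ s ×-dec at w 0 ≟ 0 ×-dec ∀<? (λ a → at w a ≤? suc n) s ×-dec at w (s ∸ 1) ≤? n ×-dec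
        ∀<? (λ b → ∀<? (λ a → (b ≤? a + d) →-dec (at w a ≟ 0 ⊎-dec at w b ≟ 0)) b) s ×-dec
        ∀<? (λ b → ∀<? (λ a → (a + s ≤? b + d) →-dec (at w a ≤? 1 ⊎-dec at w b ≟ 0)) s) s)

boundedLists : ℕ → ℕ → List (List ℕ)
boundedLists B zero = [] ∷ []
boundedLists B (suc m) = cartesianProductWith _∷_ (upTo (suc B)) (boundedLists B m)

boundedLists-unique : ∀ B m → Unique (boundedLists B m)
boundedLists-unique B zero = [] ∷ []
boundedLists-unique B (suc m) =
  Unique.cartesianProductWith⁺ _∷_ ∷-injective (Unique.upTo⁺ (suc B)) (boundedLists-unique B m)

∈-boundedLists : ∀ {B} w → All (_≤ B) w → w ∈ boundedLists B (length w)
∈-boundedLists [] [] = here refl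
∈-boundedLists (x ∷ w) (x≤B ∷ w≤B) =
  ∈-cartesianProductWith⁺ _∷_ (∈-upTo⁺ (s≤s x≤B)) (∈-boundedLists w w≤B)

All-at : ∀ {P : ℕ → Set} w → (∀ i → i < length w → P (at w i)) → All P w
All-at [] _ = []
All-at (x ∷ w) P-at = P-at 0 (s≤s z≤n) ∷ All-at w (λ i i< → P-at (suc i) (s≤s i<))

abacus-finite : ∀ d n s → Σ ℕ (HasCount (Abacus d n s))
abacus-finite d n s =
  _ , HasCount-filter (Abacus? d n s) (boundedLists (suc n) s) (boundedLists-unique (suc n) s) covered
  where
  covered : ∀ w → Abacus d n s w → w ∈ boundedLists (suc n) s
  covered w A = subst (λ m → w ∈ boundedLists (suc n) m) length≡
                  (∈-boundedLists w (All-at w (λ i i< → beads≤ i (subst (i <_) length≡ i<))))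
    where open Abacus A

-- Removing and inserting runners

insertAt : ℕ → List ℕ → List ℕ → List ℕ
insertAt p B w = take p w ++ B ++ drop p w

removeAt : ℕ → ℕ → List ℕ → List ℕ
removeAt p k w = take p w ++ drop (p + k) w

at-++ˡ : ∀ u v i → i < length u → at (u ++ v) i ≡ at u i
at-++ˡ (x ∷ u) v zero _ = refl
at-++ˡ (x ∷ u) v (suc i) (s≤s i<) = at-++ˡ u v i i<

at-++ʳ : ∀ u v i → at (u ++ v) (length u + i) ≡ at v i
at-++ʳ [] v i = refl
at-++ʳ (x ∷ u) v i = at-++ʳ u v i

at-take : ∀ p w i → i < p → at (take p w) i ≡ at w i
at-take (suc p) [] i _ = refl
at-take (suc p) (x ∷ w) zero _ = refl
at-take (suc p) (x ∷ w) (suc i) (s≤s i<p) = at-take p w i i<p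

at-drop : ∀ m w i → at (drop m w) i ≡ at w (m + i)
at-drop zero w i = refl
at-drop (suc m) [] i = refl
at-drop (suc m) (x ∷ w) i = at-drop m w i

length-take≤ : ∀ {p} (w : List ℕ) → p ≤ length w → length (take p w) ≡ p
length-take≤ {p} w p≤ = trans (length-take p w) (m≤n⇒m⊓n≡m p≤)

<⊎≥ : ∀ p i → i < p ⊎ Σ ℕ (λ j → i ≡ p + j)
<⊎≥ p i with i <? p
... | yes i<p = inj₁ i<p
... | no i≮p = inj₂ (≤⇒offset (≮⇒≥ i≮p))

record Removal (k p : ℕ) (w w′ : List ℕ) : Set where
  field
    before  : ∀ i → i < p → at w′ i ≡ at w i
    after   : ∀ i → at w′ (p + i) ≡ at w (p + k + i)
    length≡ : length w ≡ length w′ + k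

removeAt-Removal : ∀ p k w → p + k ≤ length w → Removal k p w (removeAt p k w)
removeAt-Removal p k w p+k≤ = record { before = before ; after = after ; length≡ = length≡ }
  where
  p≤ = ≤-trans (m≤m+n p k) p+k≤
  |take| = length-take≤ w p≤
  before : ∀ i → i < p → at (removeAt p k w) i ≡ at w i
  before i i<p = trans (at-++ˡ (take p w) _ i (subst (i <_) (sym |take|) i<p)) (at-take p w i i<p)
  after : ∀ i → at (removeAt p k w) (p + i) ≡ at w (p + k + i)
  after i = trans (cong (λ z → at (removeAt p k w) (z + i)) (sym |take|))
              (trans (at-++ʳ (take p w) _ i) (at-drop (p + k) w i))
  length≡ : length w ≡ length (removeAt p k w) + k
  length≡ = sym (begin
    length (removeAt p k w) + k                   ≡⟨ cong (_+ k) (length-++ (take p w)) ⟩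
    length (take p w) + length (drop (p + k) w) + k ≡⟨ cong₂ (λ a b → a + b + k) |take| (length-drop (p + k) w) ⟩
    p + (length w ∸ (p + k)) + k                  ≡⟨ shuffle p k (length w ∸ (p + k)) ⟩
    p + k + (length w ∸ (p + k))                  ≡⟨ m+[n∸m]≡n p+k≤ ⟩
    length w                                      ∎)
    where
    open ≡-Reasoning
    shuffle : ∀ p k r → p + r + k ≡ p + k + r
    shuffle = solve-∀

insertAt-Removal : ∀ p B w → p ≤ length w → Removal (length B) p (insertAt p B w) w
insertAt-Removal p B w p≤ = record { before = before ; after = after ; length≡ = length≡ }
  where
  |take| = length-take≤ w p≤
  before : ∀ i → i < p → at w i ≡ at (insertAt p B w) i
  before i i<p = sym (trans (at-++ˡ (take p w) _ i (subst (i <_) (sym |take|) i<p)) (at-take p w i i<p))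
  after : ∀ i → at w (p + i) ≡ at (insertAt p B w) (p + length B + i)
  after i = sym (begin
    at W (p + length B + i)                    ≡⟨ cong (at W) (+-assoc p (length B) i) ⟩
    at W (p + (length B + i))                  ≡⟨ cong (λ z → at W (z + (length B + i))) (sym |take|) ⟩
    at W (length (take p w) + (length B + i))  ≡⟨ at-++ʳ (take p w) _ (length B + i) ⟩
    at (B ++ drop p w) (length B + i)          ≡⟨ at-++ʳ B _ i ⟩
    at (drop p w) i                            ≡⟨ at-drop p w i ⟩
    at w (p + i)                               ∎)
    where
    open ≡-Reasoning
    W = insertAt p B w
  length≡ : length (insertAt p B w) ≡ length w + length B
  length≡ = begin
    length (insertAt p B w)                             ≡⟨ length-++ (take p w) ⟩
    length (take p w) + length (B ++ drop p w)          ≡⟨ cong₂ _+_ |take| (length-++ B) ⟩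
    p + (length B + length (drop p w))                  ≡⟨ cong (λ z → p + (length B + z)) (length-drop p w) ⟩
    p + (length B + (length w ∸ p))                     ≡⟨ shuffle p (length B) (length w ∸ p) ⟩
    p + (length w ∸ p) + length B                       ≡⟨ cong (_+ length B) (m+[n∸m]≡n p≤) ⟩
    length w + length B                                 ∎
    where
    open ≡-Reasoning
    shuffle : ∀ p b r → p + (b + r) ≡ p + r + b
    shuffle = solve-∀

at-insertAt : ∀ p B w i → p ≤ length w → i < length B → at (insertAt p B w) (p + i) ≡ at B i
at-insertAt p B w i p≤ i< =
  trans (cong (λ z → at (insertAt p B w) (z + i)) (sym (length-take≤ w p≤)))
        (trans (at-++ʳ (take p w) _ i) (at-++ˡ B _ i i<))

Removal-functional : ∀ {k p w x y} → Removal k p w x → Removal k p w y → x ≡ y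
Removal-functional {k} {p} {w} {x} {y} r₁ r₂ =
  at-injective x y (+-cancelʳ-≡ k _ _ (trans (sym (Removal.length≡ r₁)) (Removal.length≡ r₂))) at≡
  where
  at≡ : ∀ i → i < length x → at x i ≡ at y i
  at≡ i _ with <⊎≥ p i
  ... | inj₁ i<p = trans (Removal.before r₁ i i<p) (sym (Removal.before r₂ i i<p))
  ... | inj₂ (j , refl) = trans (Removal.after r₁ j) (sym (Removal.after r₂ j))

Removal-injective : ∀ {k p x y c} → Removal k p x c → Removal k p y c →
  (∀ j → j < k → at x (p + j) ≡ at y (p + j)) → x ≡ y
Removal-injective {k} {p} {x} {y} r₁ r₂ block≡ =
  at-injective x y (trans (Removal.length≡ r₁) (sym (Removal.length≡ r₂))) at≡
  where
  at≡ : ∀ i → i < length x → at x i ≡ at y i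
  at≡ i _ with <⊎≥ p i
  ... | inj₁ i<p = trans (sym (Removal.before r₁ i i<p)) (Removal.before r₂ i i<p)
  ... | inj₂ (j , refl) with j <? k
  ...   | yes j<k = block≡ j j<k
  ...   | no j≮k with j′ , refl ← ≤⇒offset (≮⇒≥ j≮k) =
    trans (cong (at x) (sym (+-assoc p k j′)))
          (trans (sym (Removal.after r₁ j′)) (trans (Removal.after r₂ j′) (cong (at y) (+-assoc p k j′))))

removeAt-insertAt : ∀ p B w {k} → length B ≡ k → p ≤ length w → removeAt p k (insertAt p B w) ≡ w
removeAt-insertAt p B w refl p≤ =
  Removal-functional (removeAt-Removal p (length B) (insertAt p B w)
                       (subst (p + length B ≤_) (sym (Removal.length≡ inserted)) (+-monoˡ-≤ (length B) p≤)))
                     inserted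
  where
  inserted = insertAt-Removal p B w p≤

insertAt-removeAt : ∀ p B w {k} → length B ≡ k → p + k ≤ length w →
  (∀ j → j < k → at B j ≡ at w (p + j)) → insertAt p B (removeAt p k w) ≡ w
insertAt-removeAt p B w refl p+k≤ block≡ =
  Removal-injective (insertAt-Removal p B w′ p≤′) removed
    (λ j j< → trans (at-insertAt p B w′ j p≤′ j<) (block≡ j j<))
  where
  removed = removeAt-Removal p (length B) w p+k≤
  w′ = removeAt p (length B) w
  p≤′ : p ≤ length w′
  p≤′ = +-cancelʳ-≤ (length B) p _ (subst (p + length B ≤_) (Removal.length≡ removed) p+k≤)

-- The split point

-- the last occupied runner among 1, …, m, or 0 if there is none
lastOccupied : List ℕ → ℕ → ℕ
lastOccupied w zero = 0
lastOccupied w (suc a) with at w (suc a) ≟ 0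
... | yes _ = lastOccupied w a
... | no _ = suc a

lastOccupied-≤ : ∀ w m → lastOccupied w m ≤ m
lastOccupied-≤ w zero = z≤n
lastOccupied-≤ w (suc a) with at w (suc a) ≟ 0
... | yes _ = m≤n⇒m≤1+n (lastOccupied-≤ w a)
... | no _ = ≤-refl

lastOccupied-above : ∀ w m a → lastOccupied w m < a → a ≤ m → at w a ≡ 0
lastOccupied-above w zero a ℓ<a a≤0 = ⊥-elim (<⇒≱ ℓ<a a≤0)
lastOccupied-above w (suc m) a ℓ<a a≤ with at w (suc m) ≟ 0
... | no _ = ⊥-elim (<⇒≱ ℓ<a a≤)
... | yes empty with m≤n⇒m<n∨m≡n a≤
...   | inj₁ a<1+m = lastOccupied-above w m a ℓ<a (≤-pred a<1+m)
...   | inj₂ refl = empty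

lastOccupied-occupied : ∀ w m → lastOccupied w m ≡ 0 ⊎ at w (lastOccupied w m) ≢ 0
lastOccupied-occupied w zero = inj₁ refl
lastOccupied-occupied w (suc a) with at w (suc a) ≟ 0
... | yes _ = lastOccupied-occupied w a
... | no nonEmpty = inj₂ nonEmpty

lastOccupied-cong : ∀ w w′ m → (∀ a → a ≤ m → at w a ≡ at w′ a) → lastOccupied w m ≡ lastOccupied w′ m
lastOccupied-cong w w′ zero _ = refl
lastOccupied-cong w w′ (suc a) at≡ with at w (suc a) ≟ 0 | at w′ (suc a) ≟ 0
... | yes _ | yes _ = lastOccupied-cong w w′ a (λ b b≤a → at≡ b (m≤n⇒m≤1+n b≤a))
... | no _ | no _ = refl
... | yes empty | no nonEmpty = ⊥-elim (nonEmpty (trans (sym (at≡ (suc a) ≤-refl)) empty))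
... | no nonEmpty | yes empty = ⊥-elim (nonEmpty (trans (at≡ (suc a) ≤-refl) empty))

splitPoint : ℕ → List ℕ → ℕ
splitPoint d w = lastOccupied w d + suc d

d<splitPoint : ∀ d w → d < splitPoint d w
d<splitPoint d w = ≤-trans (s≤s (m≤n+m d (lastOccupied w d))) (≤-reflexive (sym (+-suc (lastOccupied w d) d)))

splitPoint≤ : ∀ d {s} w → suc (d + d) ≤ s → splitPoint d w ≤ s
splitPoint≤ d w room = ≤-trans (+-monoˡ-≤ (suc d) (lastOccupied-≤ w d)) (≤-trans (≤-reflexive (+-suc d d)) room)

splitPoint-cong : ∀ {d k p w w′} → Removal k p w w′ → d < p → splitPoint d w ≡ splitPoint d w′
splitPoint-cong {d} {w = w} {w′} R d<p =
  cong (_+ suc d) (lastOccupied-cong w w′ d (λ a a≤d → sym (Removal.before R a (≤-<-trans a≤d d<p))))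

emptyBeforeSplit : ∀ {d n s w} → Abacus d n s w → suc (d + d) ≤ s →
  ∀ a → a < splitPoint d w → a ≢ lastOccupied w d → at w a ≡ 0
emptyBeforeSplit {d} {n} {s} {w} A room a a<p a≢ℓ with <-cmp a (lastOccupied w d) | lastOccupied-occupied w d
... | tri≈ _ a≡ℓ _ | _ = ⊥-elim (a≢ℓ a≡ℓ)
... | tri< a<ℓ _ _ | inj₁ ℓ≡0 = ⊥-elim (n≮0 (subst (a <_) ℓ≡0 a<ℓ))
... | tri< a<ℓ _ _ | inj₂ ℓ≢0 =
  [ id , (λ ℓ≡0 → ⊥-elim (ℓ≢0 ℓ≡0)) ]′
    (sameLevel ℓ ℓ<s a a<ℓ (≤-trans (lastOccupied-≤ w d) (m≤n+m d a)))
  where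
  open Abacus A
  ℓ = lastOccupied w d
  ℓ<s = ≤-trans (s≤s (lastOccupied-≤ w d)) (≤-trans (s≤s (m≤m+n d d)) room)
... | tri> _ _ ℓ<a | occupied with a ≤? d
...   | yes a≤d = lastOccupied-above w d a ℓ<a a≤d
...   | no a≰d with occupied
...     | inj₁ ℓ≡0 = ⊥-elim (a≰d (≤-pred (subst (λ z → a < z + suc d) ℓ≡0 a<p)))
...     | inj₂ ℓ≢0 =
  [ (λ ℓ≡0 → ⊥-elim (ℓ≢0 ℓ≡0)) , id ]′
    (sameLevel a (≤-trans a<p (splitPoint≤ d w room)) ℓ ℓ<a (≤-pred (subst (a <_) (+-suc ℓ d) a<p)))
  where
  open Abacus A
  ℓ = lastOccupied w d

nextLevel-runner< : ∀ {a b s d} → b < s → a + s ≤ b + d → a < d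
nextLevel-runner< {a} {b} {s} {d} b<s a+s≤b+d =
  +-cancelʳ-< s a d (≤-<-trans a+s≤b+d (<-≤-trans (+-monoˡ-< d b<s) (≤-reflexive (+-comm s d))))

module Deletion {d n s′ k w w′} (1≤d : 1 ≤ d) (room : suc (d + d) ≤ s′)
                (A : Abacus d n (s′ + k) w) (R : Removal k (splitPoint d w) w w′) where

  private
    module A = Abacus A
    open Removal R
    ℓ = lastOccupied w d
    p = splitPoint d w
    p≤s′ = splitPoint≤ d w room
    empty : ∀ a → a < p → a ≢ ℓ → at w a ≡ 0
    empty = emptyBeforeSplit A (≤-trans room (m≤m+n s′ k))
    widen : ∀ {x} → x < s′ → x < s′ + k
    widen x<s′ = ≤-trans x<s′ (m≤m+n _ k)
    shift< : ∀ j → p + j < s′ → p + k + j < s′ + k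
    shift< j p+j<s′ = subst (_< s′ + k) (shuffle p j k) (+-monoˡ-< k p+j<s′)
      where
      shuffle : ∀ p j k → p + j + k ≡ p + k + j
      shuffle = solve-∀
    beforeSplit : ∀ {a} → a < d → a < p
    beforeSplit a<d = ≤-trans a<d (≤-trans (n≤1+n d) (m≤n+m (suc d) ℓ))

  length≡′ : length w′ ≡ s′
  length≡′ = +-cancelʳ-≡ k _ _ (trans (sym length≡) A.length≡)

  firstEmpty : at w′ 0 ≡ 0
  firstEmpty = trans (before 0 (≤-<-trans z≤n (d<splitPoint d w))) A.firstEmpty

  beads≤ : ∀ a → a < s′ → at w′ a ≤ suc n
  beads≤ a a<s′ with <⊎≥ p a
  ... | inj₁ a<p = subst (_≤ suc n) (sym (before a a<p)) (A.beads≤ a (widen a<s′))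
  ... | inj₂ (j , refl) = subst (_≤ suc n) (sym (after j)) (A.beads≤ (p + k + j) (shift< j a<s′))

  lastBeads≤ : at w′ (s′ ∸ 1) ≤ n
  lastBeads≤ with s₁ , refl ← ≤⇒offset (≤-trans (s≤s z≤n) room) with <⊎≥ p s₁
  ... | inj₁ s₁<p = subst (_≤ n) (sym (trans (before s₁ s₁<p) (empty s₁ s₁<p s₁≢ℓ))) z≤n
    where
    p≡ : p ≡ suc s₁
    p≡ = ≤-antisym p≤s′ s₁<p
    s₁≢ℓ : s₁ ≢ ℓ
    s₁≢ℓ s₁≡ℓ = <⇒≢ 1≤d (sym (suc-injective
      (+-cancelˡ-≡ ℓ (suc d) 1 (trans p≡ (trans (cong suc s₁≡ℓ) (sym (+-comm ℓ 1)))))))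
  ... | inj₂ (j , refl) =
    subst (_≤ n) (sym (trans (after j) (cong (at w) (shuffle p k j)))) A.lastBeads≤
    where
    shuffle : ∀ p k j → p + k + j ≡ p + j + k
    shuffle = solve-∀

  sameLevel : ∀ b → b < s′ → ∀ a → a < b → b ≤ a + d → at w′ a ≡ 0 ⊎ at w′ b ≡ 0
  sameLevel b b<s′ a a<b b≤a+d with <⊎≥ p b
  ... | inj₁ b<p =
    Sum.map (trans (before a (<-trans a<b b<p))) (trans (before b b<p)) (A.sameLevel b (widen b<s′) a a<b b≤a+d)
  ... | inj₂ (j , refl) with <⊎≥ p a
  ...   | inj₁ a<p with a ≟ ℓ
  ...     | yes refl = ⊥-elim (<⇒≱ (≤-trans (s≤s b≤a+d) (≤-reflexive (sym (+-suc a d)))) (m≤m+n p j))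
  ...     | no a≢ℓ = inj₁ (trans (before a a<p) (empty a a<p a≢ℓ))
  sameLevel b b<s′ a a<b b≤a+d | inj₂ (j , refl) | inj₂ (i , refl) =
    Sum.map (trans (after i)) (trans (after j))
      (A.sameLevel (p + k + j) (shift< j b<s′) (p + k + i) (+-monoʳ-< (p + k) (+-cancelˡ-< p i j a<b))
        (subst (p + k + j ≤_) (shuffle p k i d)
          (+-monoʳ-≤ (p + k) (+-cancelˡ-≤ p j (i + d) (subst (p + j ≤_) (+-assoc p i d) b≤a+d)))))
    where
    shuffle : ∀ p k i d → p + k + (i + d) ≡ p + k + i + d
    shuffle = solve-∀

  nextLevel : ∀ b → b < s′ → ∀ a → a < s′ → a + s′ ≤ b + d → at w′ a ≤ 1 ⊎ at w′ b ≡ 0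
  nextLevel b b<s′ a a<s′ a+s′≤b+d with a ≟ ℓ
  ... | no a≢ℓ = inj₁ (subst (_≤ 1) (sym (trans (before a a<p) (empty a a<p a≢ℓ))) z≤n)
    where
    a<p = beforeSplit (nextLevel-runner< b<s′ a+s′≤b+d)
  ... | yes refl with <⊎≥ p b
  ...   | inj₁ b<p =
    ⊥-elim (<⇒≱ (≤-trans (+-monoˡ-< d b<p) (≤-reflexive (shuffle a d)))
                (≤-trans (+-monoʳ-≤ a room) a+s′≤b+d))
    where
    shuffle : ∀ a d → a + suc d + d ≡ a + suc (d + d)
    shuffle = solve-∀
  ...   | inj₂ (j , refl) =
    Sum.map (subst (_≤ 1) (sym (before a a<p))) (trans (after j))
      (A.nextLevel (p + k + j) (shift< j b<s′) a (widen a<s′)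
        (subst₂ _≤_ (+-assoc a s′ k) (shuffle p k j d) (+-monoˡ-≤ k a+s′≤b+d)))
    where
    a<p = beforeSplit (nextLevel-runner< b<s′ a+s′≤b+d)
    shuffle : ∀ p k j d → p + j + d + k ≡ p + k + j + d
    shuffle = solve-∀

  abacus : Abacus d n s′ w′
  abacus = record
    { length≡ = length≡′ ; firstEmpty = firstEmpty ; beads≤ = beads≤ ; lastBeads≤ = lastBeads≤
    ; sameLevel = sameLevel ; nextLevel = nextLevel }

data Block (d n : ℕ) : ℕ → ℕ → List ℕ → Set where
  emptyBlock : ∀ {p w} → at w p ≡ 0 → Block d n 1 p w
  beadBlock  : ∀ {p w} → at w p ≤ suc n → (∀ i → 1 ≤ i → i ≤ d → at w (p + i) ≡ 0) → Block d n (suc d) p w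

at-+0 : ∀ w p → at w (p + 0) ≡ at w p
at-+0 w p = cong (at w) (+-identityʳ p)

Block-beads≤ : ∀ {d n k p w} → Block d n k p w → ∀ i → i < k → at w (p + i) ≤ suc n
Block-beads≤ {p = p} {w} (emptyBlock empty) zero _ = subst (_≤ _) (sym (trans (at-+0 w p) empty)) z≤n
Block-beads≤ (emptyBlock _) (suc i) (s≤s ())
Block-beads≤ {p = p} {w} (beadBlock top≤ _) zero _ = subst (_≤ _) (sym (at-+0 w p)) top≤
Block-beads≤ (beadBlock _ zeros) (suc i) i< = subst (_≤ _) (sym (zeros (suc i) (s≤s z≤n) (≤-pred i<))) z≤n

Block-lastEmpty : ∀ {d n k p w} → 1 ≤ d → Block d n k p w → at w (p + k ∸ 1) ≡ 0
Block-lastEmpty {p = p} {w} _ (emptyBlock empty) = trans (cong (at w) (m+n∸n≡m p 1)) empty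
Block-lastEmpty {d} {p = p} {w} 1≤d (beadBlock _ zeros) =
  trans (cong (λ z → at w (z ∸ 1)) (+-suc p d)) (zeros d 1≤d ≤-refl)

Block-sameLevel : ∀ {d n k p w} → Block d n k p w → ∀ i j → i < k → i < j → j ≤ i + d →
  at w (p + i) ≡ 0 ⊎ at w (p + j) ≡ 0
Block-sameLevel {p = p} {w} (emptyBlock empty) zero _ _ _ _ = inj₁ (trans (at-+0 w p) empty)
Block-sameLevel (emptyBlock _) (suc i) _ (s≤s ()) _ _
Block-sameLevel (beadBlock _ zeros) zero j _ 0<j j≤d = inj₂ (zeros j 0<j j≤d)
Block-sameLevel (beadBlock _ zeros) (suc i) _ i< _ _ = inj₁ (zeros (suc i) (s≤s z≤n) (≤-pred i<))

module Insertion {d n s′ k w w′} (1≤d : 1 ≤ d) (room : suc (d + d) ≤ s′) (A : Abacus d n s′ w′)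
                 (R : Removal k (splitPoint d w′) w w′) (block : Block d n k (splitPoint d w′) w) where

  private
    module A = Abacus A
    open Removal R
    ℓ = lastOccupied w′ d
    p = splitPoint d w′
    p≤s′ = splitPoint≤ d w′ room
    empty : ∀ a → a < p → a ≢ ℓ → at w a ≡ 0
    empty a a<p a≢ℓ = trans (sym (before a a<p)) (emptyBeforeSplit A room a a<p a≢ℓ)
    beforeSplit : ∀ {a} → a < d → a < p
    beforeSplit a<d = ≤-trans a<d (≤-trans (n≤1+n d) (m≤n+m (suc d) ℓ))
    unshift : ∀ i → at w (p + (k + i)) ≡ at w′ (p + i)
    unshift i = trans (cong (at w) (sym (+-assoc p k i))) (sym (after i))
    unshift< : ∀ i → p + (k + i) < s′ + k → p + i < s′
    unshift< i p+k+i< = +-cancelʳ-< k (p + i) s′ (subst (_< s′ + k) (shuffle p k i) p+k+i<)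
      where
      shuffle : ∀ p k i → p + (k + i) ≡ p + i + k
      shuffle = solve-∀

  length≡′ : length w ≡ s′ + k
  length≡′ = trans length≡ (cong (_+ k) A.length≡)

  firstEmpty : at w 0 ≡ 0
  firstEmpty = trans (sym (before 0 (≤-<-trans z≤n (d<splitPoint d w′)))) A.firstEmpty

  beads≤ : ∀ a → a < s′ + k → at w a ≤ suc n
  beads≤ a a< with <⊎≥ p a
  ... | inj₁ a<p = subst (_≤ suc n) (before a a<p) (A.beads≤ a (<-≤-trans a<p p≤s′))
  ... | inj₂ (j , refl) with j <? k
  ...   | yes j<k = Block-beads≤ block j j<k
  ...   | no j≮k with i , refl ← ≤⇒offset (≮⇒≥ j≮k) =
    subst (_≤ suc n) (sym (unshift i)) (A.beads≤ (p + i) (unshift< i a<))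

  lastBeads≤ : at w (s′ + k ∸ 1) ≤ n
  lastBeads≤ with s₁ , refl ← ≤⇒offset (≤-trans (s≤s z≤n) room) with <⊎≥ p s₁
  ... | inj₁ s₁<p =
    subst (_≤ n) (sym (trans (cong (λ z → at w (z + k ∸ 1)) (sym p≡)) (Block-lastEmpty 1≤d block))) z≤n
    where
    p≡ : p ≡ suc s₁
    p≡ = ≤-antisym p≤s′ s₁<p
  ... | inj₂ (j , refl) = subst (_≤ n) (sym (trans (cong (at w) (shuffle p j k)) (unshift j))) A.lastBeads≤
    where
    shuffle : ∀ p j k → p + j + k ≡ p + (k + j)
    shuffle = solve-∀

  sameLevel : ∀ b → b < s′ + k → ∀ a → a < b → b ≤ a + d → at w a ≡ 0 ⊎ at w b ≡ 0
  sameLevel b b< a a<b b≤a+d with <⊎≥ p b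
  ... | inj₁ b<p = Sum.map (trans (sym (before a (<-trans a<b b<p)))) (trans (sym (before b b<p)))
                     (A.sameLevel b (<-≤-trans b<p p≤s′) a a<b b≤a+d)
  ... | inj₂ (j , refl) with <⊎≥ p a
  ...   | inj₁ a<p with a ≟ ℓ
  ...     | yes refl = ⊥-elim (<⇒≱ (≤-trans (s≤s b≤a+d) (≤-reflexive (sym (+-suc a d)))) (m≤m+n p j))
  ...     | no a≢ℓ = inj₁ (empty a a<p a≢ℓ)
  sameLevel b b< a a<b b≤a+d | inj₂ (j , refl) | inj₂ (i , refl) with i <? k
  ... | yes i<k = Block-sameLevel block i j i<k i<j j≤i+d
    where
    i<j = +-cancelˡ-< p i j a<b
    j≤i+d = +-cancelˡ-≤ p j (i + d) (subst (p + j ≤_) (+-assoc p i d) b≤a+d)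
  ... | no i≮k with i′ , refl ← ≤⇒offset (≮⇒≥ i≮k)
               with j′ , refl ← ≤⇒offset (≤-trans (m≤m+n k i′) (<⇒≤ (+-cancelˡ-< p (k + i′) j a<b))) =
    Sum.map (trans (unshift i′)) (trans (unshift j′))
      (A.sameLevel (p + j′) (unshift< j′ b<) (p + i′) (+-monoʳ-< p (+-cancelˡ-< k i′ j′ (+-cancelˡ-< p _ _ a<b)))
        (subst (p + j′ ≤_) (sym (+-assoc p i′ d)) (+-monoʳ-≤ p (+-cancelˡ-≤ k j′ (i′ + d)
          (subst (k + j′ ≤_) (+-assoc k i′ d) (+-cancelˡ-≤ p (k + j′) (k + i′ + d)
            (subst (p + (k + j′) ≤_) (+-assoc p (k + i′) d) b≤a+d)))))))

  nextLevel : ∀ b → b < s′ + k → ∀ a → a < s′ + k → a + (s′ + k) ≤ b + d → at w a ≤ 1 ⊎ at w b ≡ 0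
  nextLevel b b< a a< a+s≤b+d with a ≟ ℓ
  ... | no a≢ℓ = inj₁ (subst (_≤ 1) (sym (empty a a<p a≢ℓ)) z≤n)
    where
    a<p = beforeSplit (nextLevel-runner< b< a+s≤b+d)
  ... | yes refl with <⊎≥ (p + k) b
  ...   | inj₁ b<p+k =
    ⊥-elim (<⇒≱ (≤-trans (+-monoˡ-< d b<p+k) (≤-reflexive (shuffle a d k)))
                (≤-trans (+-monoʳ-≤ a (+-monoˡ-≤ k room)) a+s≤b+d))
    where
    shuffle : ∀ a d k → a + suc d + k + d ≡ a + (suc (d + d) + k)
    shuffle = solve-∀
  ...   | inj₂ (j , refl) =
    Sum.map (subst (_≤ 1) (before a a<p)) (trans (trans (cong (at w) (+-assoc p k j)) (unshift j)))
      (A.nextLevel (p + j) (unshift< j (subst (_< s′ + k) (+-assoc p k j) b<)) a (<-≤-trans a<p p≤s′)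
        (+-cancelʳ-≤ k (a + s′) (p + j + d) (subst₂ _≤_ (sym (+-assoc a s′ k)) (shuffle p k j d) a+s≤b+d)))
    where
    a<p = beforeSplit (nextLevel-runner< b< a+s≤b+d)
    shuffle : ∀ p k j d → p + k + j + d ≡ p + j + d + k
    shuffle = solve-∀

  abacus : Abacus d n (s′ + k) w
  abacus = record
    { length≡ = length≡′ ; firstEmpty = firstEmpty ; beads≤ = beads≤ ; lastBeads≤ = lastBeads≤
    ; sameLevel = sameLevel ; nextLevel = nextLevel }

-- The recurrence

at-replicate : ∀ m j → at (replicate m 0) j ≡ 0
at-replicate zero j = refl
at-replicate (suc m) zero = refl
at-replicate (suc m) (suc j) = at-replicate m j

module Recurrence {d n s₂ : ℕ} (1≤d : 1 ≤ d) (room : suc (d + d) ≤ s₂) where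

  private
    s = s₂ + suc d
    room₁ : suc (d + d) ≤ s₂ + d
    room₁ = ≤-trans room (m≤m+n s₂ d)
    s₂+d+1≡s : s₂ + d + 1 ≡ s
    s₂+d+1≡s = trans (+-assoc s₂ d 1) (cong (s₂ +_) (+-comm d 1))
    splitPoint≤length : ∀ {s′ w} → suc (d + d) ≤ s′ → Abacus d n s′ w → splitPoint d w ≤ length w
    splitPoint≤length {w = w} room′ A = subst (splitPoint d w ≤_) (sym (Abacus.length≡ A)) (splitPoint≤ d w room′)

  block : ℕ → List ℕ
  block i = suc i ∷ replicate d 0

  length-block : ∀ i → length (block i) ≡ suc d
  length-block i = cong suc (length-replicate d)

  Smaller : List ℕ ⊎ (ℕ × List ℕ) → Set
  Smaller = Abacus d n (s₂ + d) ⟨⊎⟩ ((_< suc n) ⟨×⟩ Abacus d n s₂)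

  grow : List ℕ ⊎ (ℕ × List ℕ) → List ℕ
  grow (inj₁ w′) = insertAt (splitPoint d w′) (0 ∷ []) w′
  grow (inj₂ (i , w′)) = insertAt (splitPoint d w′) (block i) w′

  shrinkAt : List ℕ → ℕ → List ℕ ⊎ (ℕ × List ℕ)
  shrinkAt w zero = inj₁ (removeAt (splitPoint d w) 1 w)
  shrinkAt w (suc i) = inj₂ (i , removeAt (splitPoint d w) (suc d) w)

  shrink : List ℕ → List ℕ ⊎ (ℕ × List ℕ)
  shrink w = shrinkAt w (at w (splitPoint d w))

  private
    insertBlock-Removal : ∀ i w′ → splitPoint d w′ ≤ length w′ →
      Removal (suc d) (splitPoint d w′) (insertAt (splitPoint d w′) (block i) w′) w′
    insertBlock-Removal i w′ p≤ =
      subst (λ k → Removal k (splitPoint d w′) (insertAt (splitPoint d w′) (block i) w′) w′) (length-block i)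
            (insertAt-Removal (splitPoint d w′) (block i) w′ p≤)
    at-insertBlock : ∀ i w′ j → splitPoint d w′ ≤ length w′ → j < suc d →
      at (insertAt (splitPoint d w′) (block i) w′) (splitPoint d w′ + j) ≡ at (block i) j
    at-insertBlock i w′ j p≤ j< = at-insertAt _ (block i) w′ j p≤ (subst (j <_) (sym (length-block i)) j<)

  grow-abacus : ∀ x → Smaller x → Abacus d n s (grow x)
  grow-abacus (inj₁ w′) A′ =
    subst (λ z → Abacus d n z (grow (inj₁ w′))) s₂+d+1≡s
      (Insertion.abacus 1≤d room₁ A′ (insertAt-Removal p (0 ∷ []) w′ p≤)
        (emptyBlock (trans (sym (at-+0 (grow (inj₁ w′)) p)) (at-insertAt p (0 ∷ []) w′ 0 p≤ (s≤s z≤n)))))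
    where
    p = splitPoint d w′
    p≤ = splitPoint≤length room₁ A′
  grow-abacus (inj₂ (i , w′)) (i< , A′) =
    Insertion.abacus 1≤d room A′ (insertBlock-Removal i w′ p≤)
      (beadBlock (subst (_≤ suc n) (sym (trans (sym (at-+0 (grow (inj₂ (i , w′))) p))
                                                (at-insertBlock i w′ 0 p≤ (s≤s z≤n)))) i<)
                 (λ { (suc j) _ j<d → trans (at-insertBlock i w′ (suc j) p≤ (s≤s j<d)) (at-replicate d j) }))
    where
    p = splitPoint d w′
    p≤ = splitPoint≤length room A′

  private
    module _ {w} (A : Abacus d n s w) where
      p+1+d≤ : splitPoint d w + suc d ≤ length w
      p+1+d≤ = subst (splitPoint d w + suc d ≤_) (sym (Abacus.length≡ A)) (+-monoˡ-≤ (suc d) (splitPoint≤ d w room))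
      p+1≤ : splitPoint d w + 1 ≤ length w
      p+1≤ = ≤-trans (+-monoʳ-≤ (splitPoint d w) (s≤s z≤n)) p+1+d≤

  shrink-smaller : ∀ w → Abacus d n s w → Smaller (shrink w)
  shrink-smaller w A = smaller (at w p) refl
    where
    p = splitPoint d w
    smaller : ∀ m → at w p ≡ m → Smaller (shrinkAt w m)
    smaller zero _ =
      Deletion.abacus 1≤d room₁ (subst (λ z → Abacus d n z w) (sym s₂+d+1≡s) A) (removeAt-Removal p 1 w (p+1≤ A))
    smaller (suc i) top≡ =
      subst (_≤ suc n) top≡ (Abacus.beads≤ A p (≤-trans (m<m+n p (s≤s z≤n)) splitPoint+1+d≤s))
      , Deletion.abacus 1≤d room A (removeAt-Removal p (suc d) w (p+1+d≤ A))
      where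
      splitPoint+1+d≤s = +-monoˡ-≤ (suc d) (splitPoint≤ d w room)

  shrink∘grow : ∀ x → Smaller x → shrink (grow x) ≡ x
  shrink∘grow (inj₁ w′) A′ = begin
    shrink W                              ≡⟨ cong (shrinkAt W) top≡ ⟩
    inj₁ (removeAt (splitPoint d W) 1 W)  ≡⟨ cong (λ q → inj₁ (removeAt q 1 W)) p≡ ⟩
    inj₁ (removeAt p 1 W)                 ≡⟨ cong inj₁ (removeAt-insertAt p (0 ∷ []) w′ refl p≤) ⟩
    inj₁ w′                               ∎
    where
    open ≡-Reasoning
    p = splitPoint d w′
    p≤ = splitPoint≤length room₁ A′
    W = grow (inj₁ w′)
    p≡ : splitPoint d W ≡ p
    p≡ = splitPoint-cong (insertAt-Removal p (0 ∷ []) w′ p≤) (d<splitPoint d w′)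
    top≡ : at W (splitPoint d W) ≡ 0
    top≡ = trans (cong (at W) p≡) (trans (sym (at-+0 W p)) (at-insertAt p (0 ∷ []) w′ 0 p≤ (s≤s z≤n)))
  shrink∘grow (inj₂ (i , w′)) (_ , A′) = begin
    shrink W                                         ≡⟨ cong (shrinkAt W) top≡ ⟩
    inj₂ (i , removeAt (splitPoint d W) (suc d) W)   ≡⟨ cong (λ q → inj₂ (i , removeAt q (suc d) W)) p≡ ⟩
    inj₂ (i , removeAt p (suc d) W)
      ≡⟨ cong (λ v → inj₂ (i , v)) (removeAt-insertAt p (block i) w′ (length-block i) p≤) ⟩
    inj₂ (i , w′)                                    ∎
    where
    open ≡-Reasoning
    p = splitPoint d w′
    p≤ = splitPoint≤length room A′
    W = grow (inj₂ (i , w′))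
    p≡ : splitPoint d W ≡ p
    p≡ = splitPoint-cong (insertBlock-Removal i w′ p≤) (d<splitPoint d w′)
    top≡ : at W (splitPoint d W) ≡ suc i
    top≡ = trans (cong (at W) p≡) (trans (sym (at-+0 W p)) (at-insertBlock i w′ 0 p≤ (s≤s z≤n)))

  grow∘shrink : ∀ w → Abacus d n s w → grow (shrink w) ≡ w
  grow∘shrink w A = restore (at w P) refl
    where
    P = splitPoint d w
    restore : ∀ m → at w P ≡ m → grow (shrinkAt w m) ≡ w
    restore zero top≡ =
      trans (cong (λ q → insertAt q (0 ∷ []) w′) p≡) (insertAt-removeAt P (0 ∷ []) w refl (p+1≤ A) agree)
      where
      w′ = removeAt P 1 w
      p≡ : splitPoint d w′ ≡ P
      p≡ = sym (splitPoint-cong (removeAt-Removal P 1 w (p+1≤ A)) (d<splitPoint d w))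
      agree : ∀ j → j < 1 → at (0 ∷ []) j ≡ at w (P + j)
      agree zero _ = sym (trans (at-+0 w P) top≡)
      agree (suc j) (s≤s ())
    restore (suc i) top≡ =
      trans (cong (λ q → insertAt q (block i) w′) p≡) (insertAt-removeAt P (block i) w (length-block i) (p+1+d≤ A) agree)
      where
      w′ = removeAt P (suc d) w
      p≡ : splitPoint d w′ ≡ P
      p≡ = sym (splitPoint-cong (removeAt-Removal P (suc d) w (p+1+d≤ A)) (d<splitPoint d w))
      agree : ∀ j → j < suc d → at (block i) j ≡ at w (P + j)
      agree zero _ = sym (trans (at-+0 w P) top≡)
      agree (suc j) (s≤s j<d)
        with Abacus.sameLevel A (P + suc j)
               (<-≤-trans (+-monoʳ-< P (s≤s j<d)) (subst (P + suc d ≤_) (Abacus.length≡ A) (p+1+d≤ A)))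
               P (m<m+n P (s≤s z≤n)) (+-monoʳ-≤ P j<d)
      ... | inj₁ empty = ⊥-elim (1+n≢0 (trans (sym top≡) empty))
      ... | inj₂ empty = trans (at-replicate d j) (sym empty)

  count : ∀ {b c} → HasCount (Abacus d n (s₂ + d)) b → HasCount (Abacus d n s₂) c →
    HasCount (Abacus d n (s₂ + suc d)) (b + suc n * c)
  count hb hc =
    HasCount-bijection grow shrink grow-abacus shrink-smaller shrink∘grow grow∘shrink
      (HasCount-⊎ hb (HasCount-× (HasCount-< (suc n)) hc))

abacus-partitions : ∀ {d n s k} → 1 ≤ d → 1 ≤ n → d < s → HasCount (Abacus d n s) k → N≡ d (n * s ∸ 1) s k
abacus-partitions 1≤d 1≤n d<s = betaSet-count 1≤d 1≤n (≤-trans (s≤s z≤n) d<s) ∘ abacus-count 1≤n d<s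

3d+2≡ : ∀ d → 3 * d + 2 ≡ suc (d + d) + (d + 1)
3d+2≡ = solve-∀

2d+1≤s-d-1 : ∀ d {s} → 3 * d + 2 ≤ s → suc (d + d) ≤ s ∸ d ∸ 1
2d+1≤s-d-1 d {s} 3d+2≤s =
  subst (suc (d + d) ≤_) (sym (∸-+-assoc s d 1)) (m+n≤o⇒m≤o∸n (suc (d + d)) (subst (_≤ s) (3d+2≡ d) 3d+2≤s))

abacus-recurrence : ∀ {d n s b c} → 1 ≤ d → 3 * d + 2 ≤ s →
  HasCount (Abacus d n (s ∸ 1)) b → HasCount (Abacus d n (s ∸ d ∸ 1)) c → HasCount (Abacus d n s) (b + suc n * c)
abacus-recurrence {d} {n} {s} {b} {c} 1≤d 3d+2≤s hb hc =
  subst (λ z → HasCount (Abacus d n z) (b + suc n * c)) s₂+1+d≡s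
    (Recurrence.count 1≤d (2d+1≤s-d-1 d 3d+2≤s)
      (subst (λ z → HasCount (Abacus d n z) b) (sym s₂+d≡s-1) hb) hc)
  where
  s₂ = s ∸ d ∸ 1
  s₂+1+d≡s : s₂ + suc d ≡ s
  s₂+1+d≡s = trans (cong₂ _+_ (∸-+-assoc s d 1) (+-comm 1 d))
                   (m∸n+n≡m (≤-trans (m≤n+m (d + 1) (suc (d + d))) (subst (_≤ s) (3d+2≡ d) 3d+2≤s)))
  s₂+d≡s-1 : s₂ + d ≡ s ∸ 1
  s₂+d≡s-1 = cong (_∸ 1) (trans (sym (+-suc s₂ d)) s₂+1+d≡s)

theorem6p3 : (d n s : ℕ) → 1 ≤ d → 1 ≤ n → 3 * d + 2 ≤ s →
    Σ ℕ (λ a → Σ ℕ (λ b → Σ ℕ (λ c →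
      N≡ d (n * s ∸ 1) s a
      × N≡ d (n * (s ∸ 1) ∸ 1) (s ∸ 1) b
      × N≡ d (n * (s ∸ d ∸ 1) ∸ 1) (s ∸ d ∸ 1) c
      × a ≡ b + suc n * c)))
theorem6p3 d n s 1≤d 1≤n 3d+2≤s =
  b + suc n * c , b , c ,
  abacus-partitions 1≤d 1≤n (<-≤-trans d<s-1 (m∸n≤m s 1)) (abacus-recurrence 1≤d 3d+2≤s hb hc) ,
  abacus-partitions 1≤d 1≤n d<s-1 hb ,
  abacus-partitions 1≤d 1≤n d<s-d-1 hc ,
  refl
  where
  b = proj₁ (abacus-finite d n (s ∸ 1))
  hb = proj₂ (abacus-finite d n (s ∸ 1))
  c = proj₁ (abacus-finite d n (s ∸ d ∸ 1))
  hc = proj₂ (abacus-finite d n (s ∸ d ∸ 1))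
  d<s-d-1 : d < s ∸ d ∸ 1
  d<s-d-1 = ≤-trans (s≤s (m≤m+n d d)) (2d+1≤s-d-1 d 3d+2≤s)
  d<s-1 : d < s ∸ 1
  d<s-1 = <-≤-trans d<s-d-1 (∸-monoˡ-≤ 1 (m∸n≤m s d))
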